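{- Let $p\ge 5$ be a prime and let $r$ be an integer with $1\le r\le p-1$ such that $4r+1\equiv 0\pmod p$. Then for all integers $n\ge 0$ and all integers $k\ge j\ge 0$, \[ a_{p(k-j)+(p-3),\;pk+p}(pn+r)\equiv 0 \pmod p. \]
   Context: For positive integers $r,s$, $a_{r,s}(n)$ denotes the number of multicolored partitions of $n$ in which each even part may appear in one of $r$ colors and each odd part may appear in one of $s$ colors (copies of the same part size in different colors are distinct), with $a_{r,s}(0)=1$. Equivalently, for $|q|<1$, $\sum_{n\ge0}a_{r,s}(n)q^n = f_2^{s-r}/f_1^{s}$, where $f_m=\prod_{i\ge1}(1-q^{mi})$. -}

module Defs where

open import Data.Nat using (ℕ; zero; suc; _+_; _*_; _∸_; _≤ᵇ_)
open import Data.Nat using (_%_; _≡ᵇ_)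
open import Data.Bool using (Bool; true; false; if_then_else_)
open import Data.List using (List; map; upTo)
open import Data.Nat.ListAction using (sum)

colours : ℕ → ℕ → ℕ → ℕ
colours r s i = if (i % 2) ≡ᵇ 0 then r else s

-- multisets : given a counting function `prev` (for objects built from
-- earlier "kinds"), a part size m and a number k of colours for that size,
-- counts multisets in which each of the k coloured copies of the part m
-- may be used any number of times, combined with an object counted by prev.
-- withKinds prev m k n = Σ over multiplicities (t₁,…,t_k) of prev (n - m Σ tᵢ).
withKinds : (ℕ → ℕ) → ℕ → ℕ → ℕ → ℕ
withKinds prev m zero n = prev n
withKinds prev m (suc k) n =
  sum (map (λ t → if (t * m) ≤ᵇ n then withKinds prev m k (n ∸ t * m) else 0)
           (upTo (suc n)))

-- partsUpTo r s m n : number of multicoloured partitions of n all of whose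
-- parts are ≤ m, where even parts come in r colours and odd parts in s colours.
partsUpTo : ℕ → ℕ → ℕ → ℕ → ℕ
partsUpTo r s zero zero = 1
partsUpTo r s zero (suc n) = 0
partsUpTo r s (suc m) n = withKinds (partsUpTo r s m) (suc m) (colours r s (suc m)) n

-- a r s n = a_{r,s}(n): number of multicoloured partitions of n
-- (parts of a partition of n are ≤ n), with a r s 0 = 1.
a : ℕ → ℕ → ℕ → ℕ
a r s n = partsUpTo r s n n

{-# OPTIONS --safe #-}
-- Write c(i) for the number of colours of the part size i (R for even i, S for odd i), so that
-- (∏ᵢ (1 - qⁱ)^c(i)) · Σ a_{R,S}(n) qⁿ = 1. Multiplying by f₂³ = ∏ᵢ (1 - q²ⁱ)³ and using
-- (1 - qⁱ)ᵖ ≡ 1 - q^{pi} (mod p), the hypotheses R + 3 ≡ 0 ≡ S (mod p) turn the product into a series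
-- F(qᵖ) with constant term 1 and F(qᵖ) · Σ a_{R,S}(n) qⁿ ≡ f₂³ (mod p). Inverting F(qᵖ) does not mix
-- residue classes mod p, so it suffices that p divides the coefficient of q^N in f₂³ whenever p ∣ 4N + 1.
-- By Jacobi's identity f₁³ = Σⱼ (-1)ʲ (2j + 1) q^{j(j+1)/2}, that coefficient is ±(2j + 1) if N = j(j + 1)
-- and 0 otherwise, and then 4N + 1 = (2j + 1)², so p ∣ 2j + 1.
-- Only finite products are used: with y = q^d, (y; y)ₙ³ agrees with Jacobi's sum below yⁿ⁺¹, because
-- Σ_{j≤n} (-1)ʲ (2j + 1) y^{j(j+1)/2} [2n+1, n+1+j]_y = (y; y)ₙ² (by induction on n, from a three-term
-- recurrence of Gaussian binomials) and [m+a, m]_y (y; y)ₘ ≡ 1 below y^{a+1}.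
module Submission where

open import Data.Nat using (ℕ)
open import Data.Nat.Primality using (Prime)

module PowerSeries where

  open import Data.Nat as ℕ using (ℕ; zero; suc; _∸_; _<_; _≤_; z≤n; s≤s)
  import Data.Nat.Properties as ℕ
  open import Data.Integer as ℤ using (ℤ; 0ℤ; 1ℤ; _+_; _*_; -_)
  import Data.Integer.Properties as ℤ
  open import Data.Integer.Tactic.RingSolver using (solve-∀)
  open import Relation.Binary.PropositionalEquality
  open ≡-Reasoning
  open import Relation.Binary.Definitions using (tri<; tri≈; tri>)
  open import Relation.Nullary using (contradiction; yes; no)

  Series : Set
  Series = ℕ → ℤ

  sumBelow : ℕ → (ℕ → ℤ) → ℤ
  sumBelow zero    h = 0ℤ
  sumBelow (suc L) h = h 0 + sumBelow L (λ a → h (suc a))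

  sumBelow-cong : ∀ L {h k} → (∀ a → a < L → h a ≡ k a) → sumBelow L h ≡ sumBelow L k
  sumBelow-cong zero    e = refl
  sumBelow-cong (suc L) e = cong₂ _+_ (e 0 (s≤s z≤n)) (sumBelow-cong L (λ a a<L → e (suc a) (s≤s a<L)))

  sumBelow-zero : ∀ L {h} → (∀ a → a < L → h a ≡ 0ℤ) → sumBelow L h ≡ 0ℤ
  sumBelow-zero zero    e = refl
  sumBelow-zero (suc L) e = trans (cong₂ _+_ (e 0 (s≤s z≤n)) (sumBelow-zero L (λ a a<L → e (suc a) (s≤s a<L))))
                                  (ℤ.+-identityˡ 0ℤ)

  sumBelow-+ : ∀ L h k → sumBelow L (λ a → h a + k a) ≡ sumBelow L h + sumBelow L k
  sumBelow-+ zero    h k = refl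
  sumBelow-+ (suc L) h k = trans (cong (h 0 + k 0 +_) (sumBelow-+ L (λ a → h (suc a)) (λ a → k (suc a))))
                                 (interchange (h 0) (k 0) _ _)
    where
    interchange : ∀ a b c d → (a + b) + (c + d) ≡ (a + c) + (b + d)
    interchange = solve-∀

  sumBelow-*ˡ : ∀ L c h → sumBelow L (λ a → c * h a) ≡ c * sumBelow L h
  sumBelow-*ˡ zero    c h = sym (ℤ.*-zeroʳ c)
  sumBelow-*ˡ (suc L) c h = trans (cong (c * h 0 +_) (sumBelow-*ˡ L c (λ a → h (suc a))))
                                  (sym (ℤ.*-distribˡ-+ c (h 0) _))

  sumBelow-neg : ∀ L h → sumBelow L (λ a → - h a) ≡ - sumBelow L h
  sumBelow-neg zero    h = refl
  sumBelow-neg (suc L) h = trans (cong (- h 0 +_) (sumBelow-neg L (λ a → h (suc a))))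
                                 (sym (ℤ.neg-distrib-+ (h 0) _))

  const : ℤ → Series
  const c zero    = c
  const c (suc _) = 0ℤ

  𝟘 𝟙 : Series
  𝟘 = const 0ℤ
  𝟙 = const 1ℤ

  𝟘-coeff : ∀ n → 𝟘 n ≡ 0ℤ
  𝟘-coeff zero    = refl
  𝟘-coeff (suc n) = refl

  infixl 6 _⊕_
  infixl 7 _⊛_
  infix  8 ⊖_

  opaque
    _⊕_ : Series → Series → Series
    (f ⊕ g) n = f n + g n

    ⊖_ : Series → Series
    (⊖ f) n = - f n

    _⊛_ : Series → Series → Series
    (f ⊛ g) n = sumBelow (suc n) (λ a → f a * g (n ∸ a))

    ⊕-coeff : ∀ f g n → (f ⊕ g) n ≡ f n + g n
    ⊕-coeff f g n = refl

    ⊖-coeff : ∀ f n → (⊖ f) n ≡ - f n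
    ⊖-coeff f n = refl

    ⊛-coeff : ∀ f g n → (f ⊛ g) n ≡ sumBelow (suc n) (λ a → f a * g (n ∸ a))
    ⊛-coeff f g n = refl

    ⊛-distribʳ : ∀ f g h → (f ⊕ g) ⊛ h ≗ f ⊛ h ⊕ g ⊛ h
    ⊛-distribʳ f g h n =
      trans (sumBelow-cong (suc n) (λ a _ → ℤ.*-distribʳ-+ (h (n ∸ a)) (f a) (g a)))
            (sumBelow-+ (suc n) (λ a → f a * h (n ∸ a)) (λ a → g a * h (n ∸ a)))

    ⊛-distribˡ : ∀ f g h → f ⊛ (g ⊕ h) ≗ f ⊛ g ⊕ f ⊛ h
    ⊛-distribˡ f g h n =
      trans (sumBelow-cong (suc n) (λ a _ → ℤ.*-distribˡ-+ (f a) (g (n ∸ a)) (h (n ∸ a))))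
            (sumBelow-+ (suc n) (λ a → f a * g (n ∸ a)) (λ a → f a * h (n ∸ a)))

    ⊛-negˡ : ∀ f h → (⊖ f) ⊛ h ≗ ⊖ (f ⊛ h)
    ⊛-negˡ f h n =
      trans (sumBelow-cong (suc n) (λ a _ → sym (ℤ.neg-distribˡ-* (f a) (h (n ∸ a)))))
            (sumBelow-neg (suc n) (λ a → f a * h (n ∸ a)))

    ⊛-coeff-0 : ∀ f g → (f ⊛ g) 0 ≡ f 0 * g 0
    ⊛-coeff-0 f g = ℤ.+-identityʳ (f 0 * g 0)

    ⊛-scaleˡ : ∀ c f h n → ((λ m → c * f m) ⊛ h) n ≡ c * (f ⊛ h) n
    ⊛-scaleˡ c f h n =
      trans (sumBelow-cong (suc n) (λ a _ → ℤ.*-assoc c (f a) (h (n ∸ a))))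
            (sumBelow-*ˡ (suc n) c (λ a → f a * h (n ∸ a)))

    ⊛-identityˡ : ∀ g → 𝟙 ⊛ g ≗ g
    ⊛-identityˡ g zero    = trans (ℤ.+-identityʳ _) (ℤ.*-identityˡ (g 0))
    ⊛-identityˡ g (suc n) =
      trans (cong₂ _+_ (ℤ.*-identityˡ (g (suc n))) (sumBelow-zero (suc n) (λ a _ → ℤ.*-zeroˡ (g (n ∸ a)))))
            (ℤ.+-identityʳ _)

    ⊛-last : ∀ f g n → (f ⊛ g) (suc n) ≡ (f ⊛ (λ m → g (suc m))) n + f (suc n) * g 0
    ⊛-last f g zero    = move (f 0) (g 1) (f 1) (g 0)
      where
      move : ∀ a b c d → a * b + (c * d + 0ℤ) ≡ (a * b + 0ℤ) + c * d
      move = solve-∀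
    ⊛-last f g (suc n) =
      trans (cong (f 0 * g (suc (suc n)) +_) (⊛-last (λ m → f (suc m)) g n))
            (sym (ℤ.+-assoc (f 0 * g (suc (suc n))) _ _))

    ⊛-comm : ∀ f g → f ⊛ g ≗ g ⊛ f
    ⊛-comm f g zero    = cong (_+ 0ℤ) (ℤ.*-comm (f 0) (g 0))
    ⊛-comm f g (suc n) = begin
      f 0 * g (suc n) + ((λ m → f (suc m)) ⊛ g) n  ≡⟨ cong (f 0 * g (suc n) +_) (⊛-comm (λ m → f (suc m)) g n) ⟩
      f 0 * g (suc n) + (g ⊛ (λ m → f (suc m))) n  ≡⟨ ℤ.+-comm (f 0 * g (suc n)) _ ⟩
      (g ⊛ (λ m → f (suc m))) n + f 0 * g (suc n)  ≡⟨ cong ((g ⊛ (λ m → f (suc m))) n +_) (ℤ.*-comm (f 0) (g (suc n))) ⟩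
      (g ⊛ (λ m → f (suc m))) n + g (suc n) * f 0  ≡⟨ ⊛-last g f n ⟨
      (g ⊛ f) (suc n)                               ∎

    ⊛-assoc : ∀ f g h → (f ⊛ g) ⊛ h ≗ f ⊛ (g ⊛ h)
    ⊛-assoc f g h zero = rearrange (f 0) (g 0) (h 0)
      where
      rearrange : ∀ a b c → (a * b + 0ℤ) * c + 0ℤ ≡ a * (b * c + 0ℤ) + 0ℤ
      rearrange = solve-∀
    ⊛-assoc f g h (suc n) = begin
      fg0 * h (suc n) + (fg↑ ⊛ h) n
        ≡⟨ cong (fg0 * h (suc n) +_) (⊛-distribʳ (λ m → f 0 * g↑ m) (f↑ ⊛ g) h n) ⟩
      fg0 * h (suc n) + (((λ m → f 0 * g↑ m) ⊛ h) n + ((f↑ ⊛ g) ⊛ h) n)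
        ≡⟨ cong₂ (λ x y → fg0 * h (suc n) + (x + y))
                 (⊛-scaleˡ (f 0) g↑ h n)
                 (⊛-assoc f↑ g h n) ⟩
      fg0 * h (suc n) + (f 0 * (g↑ ⊛ h) n + (f↑ ⊛ (g ⊛ h)) n)
        ≡⟨ rearrange (f 0) (g 0) (h (suc n)) _ _ ⟩
      f 0 * (g 0 * h (suc n) + (g↑ ⊛ h) n) + (f↑ ⊛ (g ⊛ h)) n
        ∎
      where
      f↑ g↑ fg↑ : Series
      f↑ m  = f (suc m)
      g↑ m  = g (suc m)
      fg↑ m = (f ⊛ g) (suc m)
      fg0 : ℤ
      fg0 = f 0 * g 0 + 0ℤ
      rearrange : ∀ a b c x y → (a * b + 0ℤ) * c + (a * x + y) ≡ a * (b * c + x) + y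
      rearrange = solve-∀

  shift : Series → Series
  shift f zero    = 0ℤ
  shift f (suc n) = f n

  q^_ : ℕ → Series
  q^ zero  = 𝟙
  q^ suc k = shift (q^ k)

  𝟙-q^_ : ℕ → Series
  𝟙-q^ k = 𝟙 ⊕ ⊖ q^ k

  opaque
    unfolding _⊛_

    shift-⊛ : ∀ f g → shift f ⊛ g ≗ shift (f ⊛ g)
    shift-⊛ f g zero    = trans (ℤ.+-identityʳ _) (ℤ.*-zeroˡ (g 0))
    shift-⊛ f g (suc n) = trans (cong (_+ (f ⊛ g) n) (ℤ.*-zeroˡ (g (suc n)))) (ℤ.+-identityˡ _)

    const-⊛ : ∀ c f n → (const c ⊛ f) n ≡ c * f n
    const-⊛ c f n = trans (cong (c * f n +_) (sumBelow-zero n (λ a _ → ℤ.*-zeroˡ (f (n ∸ suc a)))))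
                          (ℤ.+-identityʳ _)

  shift-cong : ∀ {f g} → f ≗ g → shift f ≗ shift g
  shift-cong e zero    = refl
  shift-cong e (suc n) = e n

  q^-coeff-< : ∀ k i → i < k → (q^ k) i ≡ 0ℤ
  q^-coeff-< (suc k) zero    _         = refl
  q^-coeff-< (suc k) (suc i) (s≤s i<k) = q^-coeff-< k i i<k

  q^-coeff-self : ∀ k → (q^ k) k ≡ 1ℤ
  q^-coeff-self zero    = refl
  q^-coeff-self (suc k) = q^-coeff-self k

  q^-coeff-> : ∀ k i → (q^ k) (suc (k ℕ.+ i)) ≡ 0ℤ
  q^-coeff-> zero    i = refl
  q^-coeff-> (suc k) i = q^-coeff-> k i

  q^-coeff-≢ : ∀ k i → i ≢ k → (q^ k) i ≡ 0ℤ
  q^-coeff-≢ k i i≢k with ℕ.<-cmp i k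
  ... | tri< i<k _ _ = q^-coeff-< k i i<k
  ... | tri≈ _ i≡k _ = contradiction i≡k i≢k
  ... | tri> _ _ i>k = subst (λ z → (q^ k) z ≡ 0ℤ) (ℕ.m+[n∸m]≡n i>k) (q^-coeff-> k (i ∸ suc k))

  q^-⊛-coeff-< : ∀ k f i → i < k → (q^ k ⊛ f) i ≡ 0ℤ
  q^-⊛-coeff-< (suc k) f zero    _         = shift-⊛ (q^ k) f zero
  q^-⊛-coeff-< (suc k) f (suc i) (s≤s i<k) = trans (shift-⊛ (q^ k) f (suc i)) (q^-⊛-coeff-< k f i i<k)

  q^-⊛-coeff-+ : ∀ k f n → (q^ k ⊛ f) (k ℕ.+ n) ≡ f n
  q^-⊛-coeff-+ zero    f n = ⊛-identityˡ f n
  q^-⊛-coeff-+ (suc k) f n = trans (shift-⊛ (q^ k) f (suc (k ℕ.+ n))) (q^-⊛-coeff-+ k f n)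

  q^-+ : ∀ a b → q^ a ⊛ q^ b ≗ q^ (a ℕ.+ b)
  q^-+ zero    b = ⊛-identityˡ (q^ b)
  q^-+ (suc a) b n = trans (shift-⊛ (q^ a) (q^ b) n) (shift-cong (q^-+ a b) n)

  infix 4 _≡[<_]_
  _≡[<_]_ : Series → ℕ → Series → Set
  f ≡[< K ] g = ∀ i → i < K → f i ≡ g i

  ≗⇒≡[<] : ∀ {f g K} → f ≗ g → f ≡[< K ] g
  ≗⇒≡[<] e i _ = e i

  ≡[<]-trans : ∀ {f g h K} → f ≡[< K ] g → g ≡[< K ] h → f ≡[< K ] h
  ≡[<]-trans e e′ i i<K = trans (e i i<K) (e′ i i<K)

  ≡[<]-weaken : ∀ {f g K K′} → K′ ≤ K → f ≡[< K ] g → f ≡[< K′ ] g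
  ≡[<]-weaken K′≤K e i i<K′ = e i (ℕ.<-≤-trans i<K′ K′≤K)

  opaque
    unfolding _⊛_

    ≡[<]-⊕ : ∀ {f f′ g g′ K} → f ≡[< K ] f′ → g ≡[< K ] g′ → f ⊕ g ≡[< K ] f′ ⊕ g′
    ≡[<]-⊕ e e′ i i<K = cong₂ _+_ (e i i<K) (e′ i i<K)

    ≡[<]-⊛ : ∀ {f f′ g g′ K} → f ≡[< K ] f′ → g ≡[< K ] g′ → f ⊛ g ≡[< K ] f′ ⊛ g′
    ≡[<]-⊛ e e′ i i<K = sumBelow-cong (suc i) λ a a<1+i →
      cong₂ _*_ (e a (ℕ.≤-<-trans (ℕ.≤-pred a<1+i) i<K)) (e′ (i ∸ a) (ℕ.≤-<-trans (ℕ.m∸n≤m i a) i<K))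

  q^-⊛-≡[<] : ∀ {f g K} k → f ≡[< K ] g → q^ k ⊛ f ≡[< k ℕ.+ K ] q^ k ⊛ g
  q^-⊛-≡[<] {f} {g} k e i i<k+K with k ℕ.≤? i
  ... | no  k≰i = let i<k = ℕ.≰⇒> k≰i in
    trans (q^-⊛-coeff-< k f i i<k) (sym (q^-⊛-coeff-< k g i i<k))
  ... | yes k≤i = subst (λ j → (q^ k ⊛ f) j ≡ (q^ k ⊛ g) j) (ℕ.m+[n∸m]≡n k≤i) (begin
    (q^ k ⊛ f) (k ℕ.+ (i ∸ k))  ≡⟨ q^-⊛-coeff-+ k f (i ∸ k) ⟩
    f (i ∸ k)                   ≡⟨ e (i ∸ k) (subst (i ∸ k <_) (ℕ.m+n∸m≡n k _) (ℕ.∸-monoˡ-< i<k+K k≤i)) ⟩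
    g (i ∸ k)                   ≡⟨ q^-⊛-coeff-+ k g (i ∸ k) ⟨
    (q^ k ⊛ g) (k ℕ.+ (i ∸ k))  ∎)

  Σ< : ℕ → (ℕ → Series) → Series
  Σ< zero    h = 𝟘
  Σ< (suc K) h = Σ< K h ⊕ h K

  ≡[<]-Σ< : ∀ {h h′ K} L → (∀ j → j < L → h j ≡[< K ] h′ j) → Σ< L h ≡[< K ] Σ< L h′
  ≡[<]-Σ< zero    e = λ _ _ → refl
  ≡[<]-Σ< (suc L) e = ≡[<]-⊕ (≡[<]-Σ< L (λ j j<L → e j (ℕ.m<n⇒m<1+n j<L))) (e L ℕ.≤-refl)

module Congruence where

  open import Data.Nat as ℕ using (ℕ; zero; suc; _∸_)
  import Data.Nat.Properties as ℕ
  open import Data.Integer as ℤ using (ℤ; +_; 0ℤ; _+_; _*_; -_; _-_)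
  import Data.Integer.Properties as ℤ
  open import Data.Integer.Divisibility.Signed as ℤ∣ using (_∣_; divides)
  open import Data.Integer.Tactic.RingSolver using (solve-∀)
  open import Data.Maybe using (Maybe; just; nothing)
  open import Data.Product using (_,_)
  open import Relation.Nullary using (yes; no)
  open import Relation.Binary.PropositionalEquality
  open import Algebra.Bundles using (CommutativeRing)
  open import Algebra.Structures using (IsCommutativeRing)
  open import Algebra.Solver.Ring.AlmostCommutativeRing
    using (AlmostCommutativeRing; fromCommutativeRing; _-Raw-AlmostCommutative⟶_)
  open PowerSeries

  -- Coefficientwise congruence modulo m, i.e. equality in (ℤ/mℤ)[[q]]; modulo 0 it is equality.
  infix 4 _≈[_]_
  record _≈[_]_ (f : Series) (m : ℕ) (g : Series) : Set where
    constructor mk≈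
    field coeff≈ : ∀ n → + m ∣ f n - g n
  open _≈[_]_ public

  ≗⇒≈ : ∀ {m f g} → f ≗ g → f ≈[ m ] g
  ≗⇒≈ {f = f} e = mk≈ λ n →
    subst (+ _ ∣_) (sym (trans (cong (_-_ (f n)) (sym (e n))) (ℤ.+-inverseʳ (f n)))) (divides 0ℤ refl)

  ≈[0]⇒≗ : ∀ {f g} → f ≈[ 0 ] g → f ≗ g
  ≈[0]⇒≗ {f} {g} (mk≈ e) n = begin
    f n                ≡⟨ sub-add (f n) (g n) ⟩
    (f n - g n) + g n  ≡⟨ cong (_+ g n) (ℤ∣.0∣⇒≡0 (e n)) ⟩
    0ℤ + g n           ≡⟨ ℤ.+-identityˡ (g n) ⟩
    g n                ∎
    where
    open ≡-Reasoning
    sub-add : ∀ a b → a ≡ (a - b) + b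
    sub-add = solve-∀

  ≈[0]⇒≡[<] : ∀ {f g K} → f ≈[ 0 ] g → f ≡[< K ] g
  ≈[0]⇒≡[<] e = ≗⇒≡[<] (≈[0]⇒≗ e)

  sumBelow-divisible : ∀ {m} L {h} → (∀ a → a ℕ.< L → + m ∣ h a) → + m ∣ sumBelow L h
  sumBelow-divisible zero    d = divides 0ℤ refl
  sumBelow-divisible (suc L) d =
    ℤ∣.∣m∣n⇒∣m+n (d 0 ℕ.z<s) (sumBelow-divisible L (λ a a<L → d (suc a) (ℕ.s<s a<L)))

  module Mod (m : ℕ) where

    infix 4 _≈_
    _≈_ : Series → Series → Set
    f ≈ g = f ≈[ m ] g

    private
      M∣_ : ℤ → Set
      M∣ z = + m ∣ z

      neg-sub : ∀ a b → - (a - b) ≡ b - a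
      neg-sub = solve-∀
      sub-chain : ∀ a b c → (a - b) + (b - c) ≡ a - c
      sub-chain = solve-∀
      sub-interchange : ∀ a b c d → (a + c) - (b + d) ≡ (a - b) + (c - d)
      sub-interchange = solve-∀
      sub-neg : ∀ a b → - a - - b ≡ - (a - b)
      sub-neg = solve-∀

    ≈-refl : ∀ {f} → f ≈ f
    ≈-refl = ≗⇒≈ (λ _ → refl)

    ≈-sym : ∀ {f g} → f ≈ g → g ≈ f
    ≈-sym {f} {g} (mk≈ e) = mk≈ λ n → subst M∣_ (neg-sub (f n) (g n)) (ℤ∣.∣m⇒∣-m (e n))

    ≈-trans : ∀ {f g h} → f ≈ g → g ≈ h → f ≈ h
    ≈-trans {f} {g} {h} (mk≈ e) (mk≈ e′) =
      mk≈ λ n → subst M∣_ (sub-chain (f n) (g n) (h n)) (ℤ∣.∣m∣n⇒∣m+n (e n) (e′ n))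

    ⊕-cong : ∀ {f f′ g g′} → f ≈ f′ → g ≈ g′ → f ⊕ g ≈ f′ ⊕ g′
    ⊕-cong {f} {f′} {g} {g′} (mk≈ e) (mk≈ e′) = mk≈ λ n →
      subst M∣_ (sym (trans (cong₂ _-_ (⊕-coeff f g n) (⊕-coeff f′ g′ n)) (sub-interchange (f n) (f′ n) (g n) (g′ n))))
            (ℤ∣.∣m∣n⇒∣m+n (e n) (e′ n))

    ⊖-cong : ∀ {f f′} → f ≈ f′ → ⊖ f ≈ ⊖ f′
    ⊖-cong {f} {f′} (mk≈ e) = mk≈ λ n →
      subst M∣_ (sym (trans (cong₂ _-_ (⊖-coeff f n) (⊖-coeff f′ n)) (sub-neg (f n) (f′ n)))) (ℤ∣.∣m⇒∣-m (e n))

    ⊛-congʳ : ∀ {f f′} g → f ≈ f′ → f ⊛ g ≈ f′ ⊛ g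
    ⊛-congʳ {f} {f′} g (mk≈ e) = mk≈ λ n → subst M∣_ (difference n)
      (sumBelow-divisible (suc n) {λ a → (f ⊕ ⊖ f′) a * g (n ∸ a)}
        λ a _ → subst M∣_ (cong (_* g (n ∸ a)) (sym (difference-coeff a))) (ℤ∣.∣m⇒∣m*n (g (n ∸ a)) (e a)))
      where
      difference-coeff : ∀ a → (f ⊕ ⊖ f′) a ≡ f a - f′ a
      difference-coeff a = trans (⊕-coeff f (⊖ f′) a) (cong (_+_ (f a)) (⊖-coeff f′ a))
      difference : ∀ n → sumBelow (suc n) (λ a → (f ⊕ ⊖ f′) a * g (n ∸ a)) ≡ (f ⊛ g) n - (f′ ⊛ g) n
      difference n = begin
        sumBelow (suc n) (λ a → (f ⊕ ⊖ f′) a * g (n ∸ a))  ≡⟨ ⊛-coeff (f ⊕ ⊖ f′) g n ⟨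
        ((f ⊕ ⊖ f′) ⊛ g) n                                ≡⟨ ⊛-distribʳ f (⊖ f′) g n ⟩
        (f ⊛ g ⊕ (⊖ f′) ⊛ g) n                             ≡⟨ ⊕-coeff (f ⊛ g) (⊖ f′ ⊛ g) n ⟩
        (f ⊛ g) n + ((⊖ f′) ⊛ g) n                         ≡⟨ cong (_+_ ((f ⊛ g) n)) (⊛-negˡ f′ g n) ⟩
        (f ⊛ g) n + (⊖ (f′ ⊛ g)) n                         ≡⟨ cong (_+_ ((f ⊛ g) n)) (⊖-coeff (f′ ⊛ g) n) ⟩
        (f ⊛ g) n - (f′ ⊛ g) n                             ∎
        where open ≡-Reasoning

    ⊛-cong : ∀ {f f′ g g′} → f ≈ f′ → g ≈ g′ → f ⊛ g ≈ f′ ⊛ g′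
    ⊛-cong {f} {f′} {g} {g′} e e′ = ≈-trans (⊛-congʳ g e)
      (≈-trans (≗⇒≈ (⊛-comm f′ g)) (≈-trans (⊛-congʳ f′ e′) (≗⇒≈ (⊛-comm g′ f′))))

    opaque
      unfolding _⊛_

      isCommutativeRing : IsCommutativeRing _≈_ _⊕_ _⊛_ ⊖_ 𝟘 𝟙
      isCommutativeRing = record
        { isRing = record
          { +-isAbelianGroup = record
            { isGroup = record
              { isMonoid = record
                { isSemigroup = record
                  { isMagma = record
                    { isEquivalence = record { refl = ≈-refl ; sym = ≈-sym ; trans = ≈-trans }
                    ; ∙-cong = ⊕-cong }
                  ; assoc = λ f g h → ≗⇒≈ λ n → ℤ.+-assoc (f n) (g n) (h n) }
                ; identity = (λ f → ≗⇒≈ λ n → trans (cong (_+ f n) (𝟘-coeff n)) (ℤ.+-identityˡ (f n)))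
                           , (λ f → ≗⇒≈ λ n → trans (cong (_+_ (f n)) (𝟘-coeff n)) (ℤ.+-identityʳ (f n))) }
              ; inverse = (λ f → ≗⇒≈ λ n → trans (ℤ.+-inverseˡ (f n)) (sym (𝟘-coeff n)))
                        , (λ f → ≗⇒≈ λ n → trans (ℤ.+-inverseʳ (f n)) (sym (𝟘-coeff n)))
              ; ⁻¹-cong = ⊖-cong }
            ; comm = λ f g → ≗⇒≈ λ n → ℤ.+-comm (f n) (g n) }
          ; *-cong = ⊛-cong
          ; *-assoc = λ f g h → ≗⇒≈ (⊛-assoc f g h)
          ; *-identity = (λ f → ≗⇒≈ (⊛-identityˡ f))
                       , (λ f → ≗⇒≈ λ n → trans (⊛-comm f 𝟙 n) (⊛-identityˡ f n))
          ; distrib = (λ f g h → ≗⇒≈ (⊛-distribˡ f g h))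
                    , (λ f g h → ≗⇒≈ (⊛-distribʳ g h f))
          }
        ; *-comm = λ f g → ≗⇒≈ (⊛-comm f g)
        }

    commutativeRing : CommutativeRing _ _
    commutativeRing = record { isCommutativeRing = isCommutativeRing }

    opaque
      unfolding _⊛_

      const-+ : ∀ a b → const (a + b) ≈ const a ⊕ const b
      const-+ a b = ≗⇒≈ λ { zero → refl ; (suc n) → refl }

      const-* : ∀ a b → const (a * b) ≈ const a ⊛ const b
      const-* a b = ≗⇒≈ λ n → sym (trans (const-⊛ a (const b) n) (lemma n))
        where
        lemma : ∀ n → a * const b n ≡ const (a * b) n
        lemma zero    = refl
        lemma (suc n) = ℤ.*-zeroʳ a

      const-neg : ∀ a → const (- a) ≈ ⊖ const a
      const-neg a = ≗⇒≈ λ { zero → refl ; (suc n) → refl }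

    constHomomorphism : ℤ.+-*-rawRing -Raw-AlmostCommutative⟶ fromCommutativeRing commutativeRing
    constHomomorphism = record
      { ⟦_⟧    = const
      ; +-homo = const-+
      ; *-homo = const-*
      ; -‿homo = const-neg
      ; 0-homo = ≈-refl
      ; 1-homo = ≈-refl
      }

    const-≟ : ∀ a b → Maybe (const a ≈ const b)
    const-≟ a b with a ℤ.≟ b
    ... | yes refl = just ≈-refl
    ... | no  _    = nothing

    open import Algebra.Properties.Semiring.Exp (CommutativeRing.semiring commutativeRing) public
      using (_^_; ^-congˡ; ^-homo-*; ^-assocʳ)

    open import Algebra.Solver.Ring ℤ.+-*-rawRing (fromCommutativeRing commutativeRing) constHomomorphism const-≟ public
      using (solve; _:=_; _:+_; _:*_; :-_; con)

    Σ<-cong : ∀ {h h′} K → (∀ j → h j ≈ h′ j) → Σ< K h ≈ Σ< K h′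
    Σ<-cong zero    e = ≈-refl
    Σ<-cong (suc K) e = ⊕-cong (Σ<-cong K e) (e K)

    Σ<-⊕ : ∀ h h′ K → Σ< K (λ j → h j ⊕ h′ j) ≈ Σ< K h ⊕ Σ< K h′
    Σ<-⊕ h h′ zero    = solve 0 (con 0ℤ := con 0ℤ :+ con 0ℤ) ≈-refl
    Σ<-⊕ h h′ (suc K) = ≈-trans (⊕-cong (Σ<-⊕ h h′ K) ≈-refl)
      (solve 4 (λ a b c d → a :+ b :+ (c :+ d) := a :+ c :+ (b :+ d)) ≈-refl (Σ< K h) (Σ< K h′) (h K) (h′ K))

    Σ<-⊛ˡ : ∀ c h K → Σ< K (λ j → c ⊛ h j) ≈ c ⊛ Σ< K h
    Σ<-⊛ˡ c h zero    = solve 1 (λ c → con 0ℤ := c :* con 0ℤ) ≈-refl c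
    Σ<-⊛ˡ c h (suc K) = ≈-trans (⊕-cong (Σ<-⊛ˡ c h K) ≈-refl)
      (solve 3 (λ c a b → c :* a :+ c :* b := c :* (a :+ b)) ≈-refl c (Σ< K h) (h K))

  Σ<-monomials-divisible : ∀ m K (c : ℕ → ℤ) (e : ℕ → ℕ) N → (∀ j → j ℕ.< K → e j ≡ N → + m ∣ c j) →
                           + m ∣ Σ< K (λ j → const (c j) ⊛ q^ (e j)) N
  Σ<-monomials-divisible m zero    c e N hyp = subst (+ m ∣_) (sym (𝟘-coeff N)) (divides 0ℤ refl)
  Σ<-monomials-divisible m (suc K) c e N hyp =
    subst (+ m ∣_) (sym (⊕-coeff (Σ< K h) (h K) N))
      (ℤ∣.∣m∣n⇒∣m+n (Σ<-monomials-divisible m K c e N (λ j j<K → hyp j (ℕ.m<n⇒m<1+n j<K)))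
                    (subst (+ m ∣_) (sym (const-⊛ (c K) (q^ (e K)) N)) last-term))
    where
    h : ℕ → Series
    h j = const (c j) ⊛ q^ (e j)
    last-term : + m ∣ c K * (q^ (e K)) N
    last-term with e K ℕ.≟ N
    ... | yes eK≡N = subst (λ i → + m ∣ c K * (q^ (e K)) i) eK≡N
                           (subst (+ m ∣_) (sym (trans (cong (c K *_) (q^-coeff-self (e K))) (ℤ.*-identityʳ (c K))))
                                  (hyp K ℕ.≤-refl eK≡N))
    ... | no  eK≢N = subst (+ m ∣_) (sym (trans (cong (c K *_) (q^-coeff-≢ (e K) N (λ N≡eK → eK≢N (sym N≡eK)))) (ℤ.*-zeroʳ (c K))))
                           (divides 0ℤ refl)

module TruncatedJacobi (d : ℕ) where

  open import Data.Nat as ℕ using (ℕ; zero; suc; _+_; _*_; _∸_; _≤_; _<_; z≤n; s≤s)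
  import Data.Nat.Properties as ℕ
  import Data.Integer.Properties as ℤ
  open import Data.Nat.Tactic.RingSolver using (solve-∀)
  open import Data.Integer as ℤ using (ℤ; 0ℤ; 1ℤ; -1ℤ)
  open import Data.Integer.Tactic.RingSolver using () renaming (solve-∀ to solve-∀ℤ)
  open import Relation.Binary.PropositionalEquality as ≡ using (_≡_; refl; cong; cong₂)
  open import Relation.Nullary using (yes; no)
  open import Function using (_∘_)
  open import Algebra.Bundles using (CommutativeRing)
  open PowerSeries
  open Congruence
  open Mod 0
  open CommutativeRing commutativeRing using (setoid; reflexive; +-congˡ; +-congʳ; *-congˡ; *-congʳ)
  open import Relation.Binary.Reasoning.Setoid setoid

  y^_ : ℕ → Series
  y^ k = q^ (k * d)

  y^-+ : ∀ a b → y^ (a + b) ≈ y^ a ⊛ y^ b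
  y^-+ a b = ≗⇒≈ λ n → ≡.trans (cong (λ e → (q^ e) n) (ℕ.*-distribʳ-+ d a b)) (≡.sym (q^-+ (a * d) (b * d) n))

  𝟙-y^_ : ℕ → Series
  𝟙-y^ k = 𝟙-q^ (k * d)

  poch : ℕ → Series
  poch zero    = 𝟙
  poch (suc n) = poch n ⊛ 𝟙-y^ suc n

  qbinom : ℕ → ℕ → Series
  qbinom N       zero    = 𝟙
  qbinom zero    (suc k) = 𝟘
  qbinom (suc N) (suc k) = qbinom N k ⊕ y^ suc k ⊛ qbinom N (suc k)

  qbinom-cong : ∀ {N N′ k k′} → N ≡ N′ → k ≡ k′ → qbinom N k ≈ qbinom N′ k′
  qbinom-cong e e′ = reflexive (cong₂ qbinom e e′)

  qbinom-> : ∀ N k → N < k → qbinom N k ≈ 𝟘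
  qbinom-> zero    (suc k) _         = ≈-refl
  qbinom-> (suc N) (suc k) (s≤s N<k) = begin
    qbinom N k ⊕ y^ suc k ⊛ qbinom N (suc k)
      ≈⟨ ⊕-cong (qbinom-> N k N<k) (*-congˡ (qbinom-> N (suc k) (ℕ.m<n⇒m<1+n N<k))) ⟩
    𝟘 ⊕ y^ suc k ⊛ 𝟘
      ≈⟨ solve 1 (λ y → con 0ℤ :+ y :* con 0ℤ := con 0ℤ) ≈-refl (y^ suc k) ⟩
    𝟘 ∎

  qbinom-self : ∀ N → qbinom N N ≈ 𝟙
  qbinom-self zero    = ≈-refl
  qbinom-self (suc N) = begin
    qbinom N N ⊕ y^ suc N ⊛ qbinom N (suc N)
      ≈⟨ ⊕-cong (qbinom-self N) (*-congˡ (qbinom-> N (suc N) ℕ.≤-refl)) ⟩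
    𝟙 ⊕ y^ suc N ⊛ 𝟘
      ≈⟨ solve 1 (λ y → con 1ℤ :+ y :* con 0ℤ := con 1ℤ) ≈-refl (y^ suc N) ⟩
    𝟙 ∎

  -- The exponent only matters where qbinom N k does not vanish.
  y^-y^-⊛-qbinom : ∀ a b {c} N k → (k ≤ N → a + b ≡ c) → y^ a ⊛ y^ b ⊛ qbinom N k ≈ y^ c ⊛ qbinom N k
  y^-y^-⊛-qbinom a b {c} N k eq with k ℕ.≤? N
  ... | yes k≤N = ≈-trans (*-congʳ (≈-sym (y^-+ a b))) (reflexive (cong (λ e → y^ e ⊛ qbinom N k) (eq k≤N)))
  ... | no  k≰N = begin
    y^ a ⊛ y^ b ⊛ qbinom N k  ≈⟨ *-congˡ vanish ⟩
    y^ a ⊛ y^ b ⊛ 𝟘           ≈⟨ solve 3 (λ u v w → u :* v :* con 0ℤ := w :* con 0ℤ) ≈-refl (y^ a) (y^ b) (y^ c) ⟩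
    y^ c ⊛ 𝟘                  ≈⟨ *-congˡ vanish ⟨
    y^ c ⊛ qbinom N k         ∎
    where
    vanish : qbinom N k ≈ 𝟘
    vanish = qbinom-> N k (ℕ.≰⇒> k≰N)

  qbinom-pascal′ : ∀ N k → qbinom (suc N) (suc k) ≈ y^ (N ∸ k) ⊛ qbinom N k ⊕ qbinom N (suc k)
  qbinom-pascal′ zero    zero    =
    solve 1 (λ y → con 1ℤ :+ y :* con 0ℤ := con 1ℤ :* con 1ℤ :+ con 0ℤ) ≈-refl (y^ 1)
  qbinom-pascal′ zero    (suc k) =
    solve 2 (λ y z → con 0ℤ :+ y :* con 0ℤ := z :* con 0ℤ :+ con 0ℤ) ≈-refl (y^ suc (suc k)) (y^ 0)
  qbinom-pascal′ (suc N) zero    = begin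
    𝟙 ⊕ y^ 1 ⊛ qbinom (suc N) 1
      ≈⟨ +-congˡ (*-congˡ (qbinom-pascal′ N zero)) ⟩
    𝟙 ⊕ y^ 1 ⊛ (y^ N ⊛ 𝟙 ⊕ qbinom N 1)
      ≈⟨ solve 3 (λ y₁ yN b → con 1ℤ :+ y₁ :* (yN :* con 1ℤ :+ b) := (y₁ :* yN) :* con 1ℤ :+ (con 1ℤ :+ y₁ :* b))
               ≈-refl (y^ 1) (y^ N) (qbinom N 1) ⟩
    (y^ 1 ⊛ y^ N) ⊛ 𝟙 ⊕ (𝟙 ⊕ y^ 1 ⊛ qbinom N 1)
      ≈⟨ +-congʳ (*-congʳ (y^-+ 1 N)) ⟨
    y^ suc N ⊛ 𝟙 ⊕ qbinom (suc N) 1 ∎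
  qbinom-pascal′ (suc N) (suc k) = begin
    qbinom (suc N) (suc k) ⊕ y^ k+2 ⊛ qbinom (suc N) (suc (suc k))
      ≈⟨ ⊕-cong (qbinom-pascal′ N k) (*-congˡ (qbinom-pascal′ N (suc k))) ⟩
    y^ (N ∸ k) ⊛ qbinom N k ⊕ qbinom N (suc k) ⊕ y^ k+2 ⊛ (y^ (N ∸ suc k) ⊛ qbinom N (suc k) ⊕ qbinom N (suc (suc k)))
      ≈⟨ solve 6 (λ u b₀ b₁ w v b₂ → u :* b₀ :+ b₁ :+ w :* (v :* b₁ :+ b₂) := u :* b₀ :+ b₁ :+ w :* v :* b₁ :+ w :* b₂)
               ≈-refl (y^ (N ∸ k)) (qbinom N k) (qbinom N (suc k)) (y^ k+2) (y^ (N ∸ suc k)) (qbinom N (suc (suc k))) ⟩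
    y^ (N ∸ k) ⊛ qbinom N k ⊕ qbinom N (suc k) ⊕ y^ k+2 ⊛ y^ (N ∸ suc k) ⊛ qbinom N (suc k) ⊕ y^ k+2 ⊛ qbinom N (suc (suc k))
      ≈⟨ +-congʳ (+-congˡ (≈-trans (y^-y^-⊛-qbinom k+2 (N ∸ suc k) N (suc k) (exponent-left N k))
                                   (≈-sym (y^-y^-⊛-qbinom (N ∸ k) (suc k) N (suc k) (exponent-right N k))))) ⟩
    y^ (N ∸ k) ⊛ qbinom N k ⊕ qbinom N (suc k) ⊕ y^ (N ∸ k) ⊛ y^ suc k ⊛ qbinom N (suc k) ⊕ y^ k+2 ⊛ qbinom N (suc (suc k))
      ≈⟨ solve 6 (λ u b₀ b₁ v w b₂ → u :* b₀ :+ b₁ :+ u :* v :* b₁ :+ w :* b₂ := u :* (b₀ :+ v :* b₁) :+ (b₁ :+ w :* b₂))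
               ≈-refl (y^ (N ∸ k)) (qbinom N k) (qbinom N (suc k)) (y^ suc k) (y^ k+2) (qbinom N (suc (suc k))) ⟩
    y^ (N ∸ k) ⊛ qbinom (suc N) (suc k) ⊕ qbinom (suc N) (suc (suc k)) ∎
    where
    k+2 : ℕ
    k+2 = suc (suc k)
    exponent-left : ∀ N k → suc k ≤ N → suc (suc k) + (N ∸ suc k) ≡ suc N
    exponent-left N k k<N = cong suc (ℕ.m+[n∸m]≡n k<N)
    exponent-right : ∀ N k → suc k ≤ N → (N ∸ k) + suc k ≡ suc N
    exponent-right N k k<N = ≡.trans (ℕ.+-suc (N ∸ k) k) (cong suc (ℕ.m∸n+n≡m (ℕ.<⇒≤ k<N)))

  qbinom-sym : ∀ N a b → a + b ≡ N → qbinom N a ≈ qbinom N b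
  qbinom-sym N zero    b       refl = ≈-sym (qbinom-self b)
  qbinom-sym N (suc a) zero    refl = ≈-trans (qbinom-cong {N = N} refl (≡.sym (ℕ.+-identityʳ (suc a)))) (qbinom-self N)
  qbinom-sym zero    (suc a) (suc b) ()
  qbinom-sym (suc N) (suc a) (suc b) a+b+2≡N+1 = begin
    qbinom N a ⊕ y^ suc a ⊛ qbinom N (suc a)
      ≈⟨ ⊕-cong (qbinom-sym N a (suc b) a+b+1≡N) (*-congˡ (qbinom-sym N (suc a) b (≡.trans (≡.sym (ℕ.+-suc a b)) a+b+1≡N))) ⟩
    qbinom N (suc b) ⊕ y^ suc a ⊛ qbinom N b
      ≈⟨ solve 3 (λ x y b → x :+ y :* b := y :* b :+ x) ≈-refl (qbinom N (suc b)) (y^ suc a) (qbinom N b) ⟩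
    y^ suc a ⊛ qbinom N b ⊕ qbinom N (suc b)
      ≈⟨ +-congʳ (*-congʳ (reflexive (cong y^_ N∸b≡a+1))) ⟨
    y^ (N ∸ b) ⊛ qbinom N b ⊕ qbinom N (suc b)
      ≈⟨ qbinom-pascal′ N b ⟨
    qbinom (suc N) (suc b) ∎
    where
    a+b+1≡N : a + suc b ≡ N
    a+b+1≡N = ℕ.suc-injective a+b+2≡N+1
    N∸b≡a+1 : N ∸ b ≡ suc a
    N∸b≡a+1 = ≡.trans (cong (_∸ b) (≡.trans (≡.sym a+b+1≡N) (ℕ.+-suc a b))) (ℕ.m+n∸n≡m (suc a) b)

  qbinom-three-term : ∀ N k → qbinom (suc (suc N)) (suc (suc k)) ≈
    y^ (N ∸ k) ⊛ qbinom N k ⊕ (𝟙 ⊕ y^ suc N) ⊛ qbinom N (suc k) ⊕ y^ suc (suc k) ⊛ qbinom N (suc (suc k))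
  qbinom-three-term N k = begin
    qbinom (suc N) (suc k) ⊕ y^ k+2 ⊛ qbinom (suc N) (suc (suc k))
      ≈⟨ ⊕-cong (qbinom-pascal′ N k) (*-congˡ (qbinom-pascal′ N (suc k))) ⟩
    y^ (N ∸ k) ⊛ qbinom N k ⊕ qbinom N (suc k) ⊕ y^ k+2 ⊛ (y^ (N ∸ suc k) ⊛ qbinom N (suc k) ⊕ qbinom N (suc (suc k)))
      ≈⟨ solve 6 (λ u b₀ b₁ w v b₂ → u :* b₀ :+ b₁ :+ w :* (v :* b₁ :+ b₂) := u :* b₀ :+ b₁ :+ w :* v :* b₁ :+ w :* b₂)
               ≈-refl (y^ (N ∸ k)) (qbinom N k) (qbinom N (suc k)) (y^ k+2) (y^ (N ∸ suc k)) (qbinom N (suc (suc k))) ⟩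
    y^ (N ∸ k) ⊛ qbinom N k ⊕ qbinom N (suc k) ⊕ y^ k+2 ⊛ y^ (N ∸ suc k) ⊛ qbinom N (suc k) ⊕ y^ k+2 ⊛ qbinom N (suc (suc k))
      ≈⟨ +-congʳ (+-congˡ (y^-y^-⊛-qbinom k+2 (N ∸ suc k) N (suc k) (λ k<N → cong suc (ℕ.m+[n∸m]≡n k<N)))) ⟩
    y^ (N ∸ k) ⊛ qbinom N k ⊕ qbinom N (suc k) ⊕ y^ suc N ⊛ qbinom N (suc k) ⊕ y^ k+2 ⊛ qbinom N (suc (suc k))
      ≈⟨ solve 5 (λ u b₀ b₁ t b₂ → u :* b₀ :+ b₁ :+ t :* b₁ :+ b₂ := u :* b₀ :+ (con 1ℤ :+ t) :* b₁ :+ b₂)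
               ≈-refl (y^ (N ∸ k)) (qbinom N k) (qbinom N (suc k)) (y^ suc N) (y^ k+2 ⊛ qbinom N (suc (suc k))) ⟩
    y^ (N ∸ k) ⊛ qbinom N k ⊕ (𝟙 ⊕ y^ suc N) ⊛ qbinom N (suc k) ⊕ y^ k+2 ⊛ qbinom N (suc (suc k)) ∎
    where
    k+2 : ℕ
    k+2 = suc (suc k)

  triangle : ℕ → ℕ
  triangle zero    = 0
  triangle (suc j) = triangle j + suc j

  jacobiTerm : ℕ → ℕ → Series
  jacobiTerm n j = y^ triangle j ⊛ qbinom (suc (n + n)) (suc (n + j))

  jacobiTerm-vanishes : ∀ n j → n < j → jacobiTerm n j ≈ 𝟘
  jacobiTerm-vanishes n j n<j = begin
    y^ triangle j ⊛ qbinom (suc (n + n)) (suc (n + j))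
      ≈⟨ *-congˡ (qbinom-> (suc (n + n)) (suc (n + j)) (s≤s (ℕ.+-monoʳ-< n n<j))) ⟩
    y^ triangle j ⊛ 𝟘
      ≈⟨ solve 1 (λ y → y :* con 0ℤ := con 0ℤ) ≈-refl (y^ triangle j) ⟩
    𝟘 ∎

  private
    upper-neighbour : ∀ n j → let N = suc (n + n) in
      y^ triangle j ⊛ y^ suc (suc (n + j)) ⊛ qbinom N (suc (suc (n + j))) ≈ y^ suc n ⊛ jacobiTerm n (suc j)
    upper-neighbour n j = begin
      y^ triangle j ⊛ y^ suc (suc (n + j)) ⊛ qbinom N (suc (suc (n + j)))
        ≈⟨ *-congʳ (y^-+ (triangle j) (suc (suc (n + j)))) ⟨
      y^ (triangle j + suc (suc (n + j))) ⊛ qbinom N (suc (suc (n + j)))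
        ≈⟨ reflexive (cong₂ (λ e k → y^ e ⊛ qbinom N k) (exponent (triangle j) n j) (cong suc (≡.sym (ℕ.+-suc n j)))) ⟩
      y^ (suc n + triangle (suc j)) ⊛ qbinom N (suc (n + suc j))
        ≈⟨ *-congʳ (y^-+ (suc n) (triangle (suc j))) ⟩
      y^ suc n ⊛ y^ triangle (suc j) ⊛ qbinom N (suc (n + suc j))
        ≈⟨ solve 3 (λ a b c → a :* b :* c := a :* (b :* c)) ≈-refl (y^ suc n) (y^ triangle (suc j)) (qbinom N (suc (n + suc j))) ⟩
      y^ suc n ⊛ jacobiTerm n (suc j) ∎
      where
      N : ℕ
      N = suc (n + n)
      exponent : ∀ t n j → t + suc (suc (n + j)) ≡ suc n + (t + suc j)
      exponent = solve-∀

    lower-neighbour : ∀ n j → let N = suc (n + n) in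
      y^ triangle j ⊛ y^ (N ∸ (n + j)) ⊛ qbinom N (n + j) ≈ y^ suc n ⊛ jacobiTerm n (j ∸ 1)
    lower-neighbour n zero = begin
      y^ 0 ⊛ y^ (N ∸ (n + 0)) ⊛ qbinom N (n + 0)
        ≈⟨ y^-y^-⊛-qbinom 0 (N ∸ (n + 0)) N (n + 0) (λ _ → exponent) ⟩
      y^ suc n ⊛ qbinom N (n + 0)
        ≈⟨ *-congˡ (qbinom-sym N (n + 0) (suc (n + 0)) halves) ⟩
      y^ suc n ⊛ qbinom N (suc (n + 0))
        ≈⟨ solve 2 (λ y b → y :* b := y :* (con 1ℤ :* b)) ≈-refl (y^ suc n) (qbinom N (suc (n + 0))) ⟩
      y^ suc n ⊛ jacobiTerm n 0 ∎
      where
      N : ℕ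
      N = suc (n + n)
      halves : n + 0 + suc (n + 0) ≡ N
      halves = ≡.trans (ℕ.+-suc (n + 0) (n + 0)) (cong suc (cong₂ _+_ (ℕ.+-identityʳ n) (ℕ.+-identityʳ n)))
      exponent : N ∸ (n + 0) ≡ suc n
      exponent = ≡.trans (cong (N ∸_) (ℕ.+-identityʳ n)) (≡.trans (ℕ.+-∸-assoc 1 (ℕ.m≤n+m n n)) (cong suc (ℕ.m+n∸n≡m n n)))
    lower-neighbour n (suc i) = begin
      y^ triangle (suc i) ⊛ y^ (N ∸ (n + suc i)) ⊛ qbinom N (n + suc i)
        ≈⟨ *-congˡ (qbinom-cong refl (ℕ.+-suc n i)) ⟩
      y^ triangle (suc i) ⊛ y^ (N ∸ (n + suc i)) ⊛ qbinom N (suc (n + i))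
        ≈⟨ y^-y^-⊛-qbinom (triangle (suc i)) (N ∸ (n + suc i)) N (suc (n + i)) (λ le → exponent (ℕ.+-cancelˡ-≤ n i n (ℕ.≤-pred le))) ⟩
      y^ (suc n + triangle i) ⊛ qbinom N (suc (n + i))
        ≈⟨ *-congʳ (y^-+ (suc n) (triangle i)) ⟩
      y^ suc n ⊛ y^ triangle i ⊛ qbinom N (suc (n + i))
        ≈⟨ solve 3 (λ a b c → a :* b :* c := a :* (b :* c)) ≈-refl (y^ suc n) (y^ triangle i) (qbinom N (suc (n + i))) ⟩
      y^ suc n ⊛ jacobiTerm n i ∎
      where
      N : ℕ
      N = suc (n + n)
      regroup : ∀ t i x → t + suc i + x ≡ suc (i + x) + t
      regroup = solve-∀
      exponent : i ≤ n → triangle (suc i) + (N ∸ (n + suc i)) ≡ suc n + triangle i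
      exponent i≤n = ≡.trans (cong (triangle (suc i) +_) N∸[n+i+1]≡n∸i)
                     (≡.trans (regroup (triangle i) i (n ∸ i)) (cong (λ m → suc m + triangle i) (ℕ.m+[n∸m]≡n i≤n)))
        where
        N∸[n+i+1]≡n∸i : N ∸ (n + suc i) ≡ n ∸ i
        N∸[n+i+1]≡n∸i = ≡.trans (cong (N ∸_) (ℕ.+-suc n i)) (ℕ.[m+n]∸[m+o]≡n∸o n n i)

  -- The term for j = -1 of the bilateral sum equals the one for j = 0 (qbinom-sym), hence j ∸ 1.
  jacobiTerm-recurrence : ∀ n j → jacobiTerm (suc n) j ≈
    (𝟙 ⊕ y^ (suc n + suc n)) ⊛ jacobiTerm n j ⊕ y^ suc n ⊛ (jacobiTerm n (suc j) ⊕ jacobiTerm n (j ∸ 1))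
  jacobiTerm-recurrence n j = begin
    A ⊛ qbinom (suc (suc n + suc n)) (suc (suc n + j))
      ≈⟨ *-congˡ (qbinom-cong {k = suc (suc k)} (cong (suc ∘ suc) (ℕ.+-suc n n)) refl) ⟩
    A ⊛ qbinom (suc (suc N)) (suc (suc k))
      ≈⟨ *-congˡ (qbinom-three-term N k) ⟩
    A ⊛ (y^ (N ∸ k) ⊛ qbinom N k ⊕ (𝟙 ⊕ y^ suc N) ⊛ qbinom N (suc k) ⊕ y^ suc (suc k) ⊛ qbinom N (suc (suc k)))
      ≈⟨ solve 7 (λ a u b₀ t b₁ w b₂ → a :* (u :* b₀ :+ (con 1ℤ :+ t) :* b₁ :+ w :* b₂)
                                      := (con 1ℤ :+ t) :* (a :* b₁) :+ (a :* w :* b₂ :+ a :* u :* b₀))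
               ≈-refl A (y^ (N ∸ k)) (qbinom N k) (y^ suc N) (qbinom N (suc k)) (y^ suc (suc k)) (qbinom N (suc (suc k))) ⟩
    (𝟙 ⊕ y^ suc N) ⊛ jacobiTerm n j ⊕ (A ⊛ y^ suc (suc k) ⊛ qbinom N (suc (suc k)) ⊕ A ⊛ y^ (N ∸ k) ⊛ qbinom N k)
      ≈⟨ ⊕-cong (*-congʳ (+-congˡ (reflexive (cong (y^_ ∘ suc) (≡.sym (ℕ.+-suc n n))))))
                (⊕-cong (upper-neighbour n j) (lower-neighbour n j)) ⟩
    (𝟙 ⊕ y^ (suc n + suc n)) ⊛ jacobiTerm n j ⊕ (y^ suc n ⊛ jacobiTerm n (suc j) ⊕ y^ suc n ⊛ jacobiTerm n (j ∸ 1))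
      ≈⟨ +-congˡ (solve 3 (λ s x z → s :* x :+ s :* z := s :* (x :+ z)) ≈-refl (y^ suc n) (jacobiTerm n (suc j)) (jacobiTerm n (j ∸ 1))) ⟩
    (𝟙 ⊕ y^ (suc n + suc n)) ⊛ jacobiTerm n j ⊕ y^ suc n ⊛ (jacobiTerm n (suc j) ⊕ jacobiTerm n (j ∸ 1)) ∎
    where
    A : Series
    A = y^ triangle j
    N k : ℕ
    N = suc (n + n)
    k = n + j

  -- (-1)ʲ (2j + 1), written so that the second factor computes to ℤ.+ suc (j + j).
  jacobiCoeff : ℕ → ℤ
  jacobiCoeff j = -1ℤ ℤ.^ j ℤ.* (1ℤ ℤ.+ (ℤ.+ j ℤ.+ ℤ.+ j))

  jacobiCoeff-recurrence : ∀ j →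
    jacobiCoeff (suc (suc j)) ≡ ℤ.- (jacobiCoeff j ℤ.+ ℤ.+ 2 ℤ.* jacobiCoeff (suc j))
  jacobiCoeff-recurrence j = identity (-1ℤ ℤ.^ j) (ℤ.+ j)
    where
    identity : ∀ s x → (-1ℤ ℤ.* (-1ℤ ℤ.* s)) ℤ.* (1ℤ ℤ.+ ((1ℤ ℤ.+ (1ℤ ℤ.+ x)) ℤ.+ (1ℤ ℤ.+ (1ℤ ℤ.+ x)))) ≡
                       ℤ.- (s ℤ.* (1ℤ ℤ.+ (x ℤ.+ x)) ℤ.+ ℤ.+ 2 ℤ.* ((-1ℤ ℤ.* s) ℤ.* (1ℤ ℤ.+ ((1ℤ ℤ.+ x) ℤ.+ (1ℤ ℤ.+ x)))))
    identity = solve-∀ℤ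

  weight : ℕ → Series
  weight j = const (jacobiCoeff j)

  weight-recurrence : ∀ j → weight (suc (suc j)) ≈ ⊖ (weight j ⊕ const (ℤ.+ 2) ⊛ weight (suc j))
  weight-recurrence j = begin
    const (jacobiCoeff (suc (suc j)))
      ≈⟨ reflexive (cong const (jacobiCoeff-recurrence j)) ⟩
    const (ℤ.- (jacobiCoeff j ℤ.+ ℤ.+ 2 ℤ.* jacobiCoeff (suc j)))
      ≈⟨ ≈-trans (const-neg _) (⊖-cong (≈-trans (const-+ _ _) (+-congˡ (const-* _ _)))) ⟩
    ⊖ (weight j ⊕ const (ℤ.+ 2) ⊛ weight (suc j)) ∎

  -- Summation by parts against the three-term recurrence of the Jacobi coefficients.
  weight-telescope : ∀ (f : ℕ → Series) K →
    Σ< (suc K) (λ j → weight j ⊛ (f (suc j) ⊕ f (j ∸ 1))) ≈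
    const (ℤ.- ℤ.+ 2) ⊛ Σ< (suc K) (λ j → weight j ⊛ f j) ⊕ weight K ⊛ f (suc K) ⊕ ⊖ (weight (suc K) ⊛ f K)
  weight-telescope f zero = solve 2 (λ f₀ f₁ → con 0ℤ :+ con 1ℤ :* (f₁ :+ f₀)
                                         := con (ℤ.- ℤ.+ 2) :* (con 0ℤ :+ con 1ℤ :* f₀) :+ con 1ℤ :* f₁ :+ :- (con (ℤ.- ℤ.+ 3) :* f₀))
                                ≈-refl (f 0) (f 1)
  weight-telescope f (suc K) = begin
    Σ< (suc K) g ⊕ weight (suc K) ⊛ (f (suc (suc K)) ⊕ f K)
      ≈⟨ +-congʳ (weight-telescope f K) ⟩
    c ⊛ ΣK ⊕ weight K ⊛ f (suc K) ⊕ ⊖ (weight (suc K) ⊛ f K) ⊕ weight (suc K) ⊛ (f (suc (suc K)) ⊕ f K)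
      ≈⟨ solve 6 (λ S a b x y z → con (ℤ.- ℤ.+ 2) :* S :+ a :* x :+ :- (b :* y) :+ b :* (z :+ y)
                                 := con (ℤ.- ℤ.+ 2) :* (S :+ b :* x) :+ b :* z :+ :- ((:- (a :+ con (ℤ.+ 2) :* b)) :* x))
               ≈-refl ΣK (weight K) (weight (suc K)) (f (suc K)) (f K) (f (suc (suc K))) ⟩
    c ⊛ (ΣK ⊕ weight (suc K) ⊛ f (suc K)) ⊕ weight (suc K) ⊛ f (suc (suc K)) ⊕ ⊖ (⊖ (weight K ⊕ const (ℤ.+ 2) ⊛ weight (suc K)) ⊛ f (suc K))
      ≈⟨ +-congˡ (⊖-cong (*-congʳ (weight-recurrence K))) ⟨
    c ⊛ (ΣK ⊕ weight (suc K) ⊛ f (suc K)) ⊕ weight (suc K) ⊛ f (suc (suc K)) ⊕ ⊖ (weight (suc (suc K)) ⊛ f (suc K)) ∎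
    where
    g : ℕ → Series
    g j = weight j ⊛ (f (suc j) ⊕ f (j ∸ 1))
    c ΣK : Series
    c  = const (ℤ.- ℤ.+ 2)
    ΣK = Σ< (suc K) (λ j → weight j ⊛ f j)

  jacobiSum : ℕ → Series
  jacobiSum n = Σ< (suc n) (λ j → weight j ⊛ jacobiTerm n j)

  jacobiSum-step : ∀ n → jacobiSum (suc n) ≈ 𝟙-y^ suc n ⊛ 𝟙-y^ suc n ⊛ jacobiSum n
  jacobiSum-step n = begin
    Σ< (suc (suc n)) (λ j → weight j ⊛ jacobiTerm (suc n) j)
      ≈⟨ Σ<-cong (suc (suc n)) (λ j → *-congˡ (jacobiTerm-recurrence n j)) ⟩
    Σ< (suc (suc n)) (λ j → weight j ⊛ (a ⊛ e j ⊕ s ⊛ (e (suc j) ⊕ e (j ∸ 1))))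
      ≈⟨ Σ<-cong (suc (suc n)) (λ j → solve 5 (λ w a x s z → w :* (a :* x :+ s :* z) := a :* (w :* x) :+ s :* (w :* z))
                                                ≈-refl (weight j) a (e j) s (e (suc j) ⊕ e (j ∸ 1))) ⟩
    Σ< (suc (suc n)) (λ j → a ⊛ (weight j ⊛ e j) ⊕ s ⊛ (weight j ⊛ (e (suc j) ⊕ e (j ∸ 1))))
      ≈⟨ ≈-trans (Σ<-⊕ _ _ (suc (suc n))) (⊕-cong (Σ<-⊛ˡ a _ (suc (suc n))) (Σ<-⊛ˡ s _ (suc (suc n)))) ⟩
    a ⊛ Σ′ ⊕ s ⊛ Σ< (suc (suc n)) (λ j → weight j ⊛ (e (suc j) ⊕ e (j ∸ 1)))
      ≈⟨ +-congˡ (*-congˡ (weight-telescope e (suc n))) ⟩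
    a ⊛ Σ′ ⊕ s ⊛ (c ⊛ Σ′ ⊕ weight (suc n) ⊛ e (suc (suc n)) ⊕ ⊖ (weight (suc (suc n)) ⊛ e (suc n)))
      ≈⟨ ⊕-cong (*-congˡ Σ′≈S) (*-congˡ (⊕-cong (⊕-cong (*-congˡ Σ′≈S) (*-congˡ e[n+2]≈0)) (⊖-cong (*-congˡ e[n+1]≈0)))) ⟩
    a ⊛ S ⊕ s ⊛ (c ⊛ S ⊕ weight (suc n) ⊛ 𝟘 ⊕ ⊖ (weight (suc (suc n)) ⊛ 𝟘))
      ≈⟨ +-congʳ (*-congʳ (+-congˡ (y^-+ (suc n) (suc n)))) ⟩
    (𝟙 ⊕ s ⊛ s) ⊛ S ⊕ s ⊛ (c ⊛ S ⊕ weight (suc n) ⊛ 𝟘 ⊕ ⊖ (weight (suc (suc n)) ⊛ 𝟘))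
      ≈⟨ solve 4 (λ s S w₁ w₂ → (con 1ℤ :+ s :* s) :* S :+ s :* (con (ℤ.- ℤ.+ 2) :* S :+ w₁ :* con 0ℤ :+ :- (w₂ :* con 0ℤ))
                               := (con 1ℤ :+ :- s) :* (con 1ℤ :+ :- s) :* S)
               ≈-refl s S (weight (suc n)) (weight (suc (suc n))) ⟩
    𝟙-y^ suc n ⊛ 𝟙-y^ suc n ⊛ S ∎
    where
    e : ℕ → Series
    e = jacobiTerm n
    a s c S Σ′ : Series
    a  = 𝟙 ⊕ y^ (suc n + suc n)
    s  = y^ suc n
    c  = const (ℤ.- ℤ.+ 2)
    S  = jacobiSum n
    Σ′ = Σ< (suc (suc n)) (λ j → weight j ⊛ e j)
    e[n+1]≈0 : e (suc n) ≈ 𝟘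
    e[n+1]≈0 = jacobiTerm-vanishes n (suc n) ℕ.≤-refl
    e[n+2]≈0 : e (suc (suc n)) ≈ 𝟘
    e[n+2]≈0 = jacobiTerm-vanishes n (suc (suc n)) (ℕ.m<n⇒m<1+n ℕ.≤-refl)
    Σ′≈S : Σ′ ≈ S
    Σ′≈S = ≈-trans (+-congˡ (*-congˡ e[n+1]≈0))
                   (solve 2 (λ S w → S :+ w :* con 0ℤ := S) ≈-refl S (weight (suc n)))

  jacobiSum≈poch² : ∀ n → jacobiSum n ≈ poch n ⊛ poch n
  jacobiSum≈poch² zero    =
    solve 1 (λ y → con 0ℤ :+ con 1ℤ :* (con 1ℤ :* (con 1ℤ :+ y :* con 0ℤ)) := con 1ℤ :* con 1ℤ) ≈-refl (y^ 1)
  jacobiSum≈poch² (suc n) = ≈-trans (jacobiSum-step n) (≈-trans (*-congˡ (jacobiSum≈poch² n))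
    (solve 2 (λ o P → o :* o :* (P :* P) := P :* o :* (P :* o)) ≈-refl (𝟙-y^ suc n) (poch n)))

  𝟙-y^-≡[<] : ∀ K k → K ≤ k → 𝟙-y^ k ≡[< K * d ] 𝟙
  𝟙-y^-≡[<] K k K≤k i i<Kd = ≡.trans (⊕-coeff 𝟙 (⊖ y^ k) i)
    (≡.trans (cong (ℤ._+_ (𝟙 i)) (≡.trans (⊖-coeff (y^ k) i) (cong ℤ.-_ (q^-coeff-< (k * d) i i<kd))))
             (ℤ.+-identityʳ (𝟙 i)))
    where
    i<kd : i < k * d
    i<kd = ℕ.<-≤-trans i<Kd (ℕ.*-monoˡ-≤ d K≤k)

  poch-≡[<] : ∀ m t → poch (t + m) ≡[< suc m * d ] poch m
  poch-≡[<] m zero    = λ _ _ → refl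
  poch-≡[<] m (suc t) = ≡[<]-trans
    (≡[<]-⊛ (poch-≡[<] m t) (𝟙-y^-≡[<] (suc m) (suc (t + m)) (s≤s (ℕ.m≤n+m m t))))
    (≈[0]⇒≡[<] (solve 1 (λ P → P :* con 1ℤ := P) ≈-refl (poch m)))

  qbinom⊛poch-≡[<] : ∀ a m → qbinom (m + a) m ⊛ poch m ≡[< suc a * d ] 𝟙
  qbinom⊛poch-≡[<] a       zero    = ≈[0]⇒≡[<] (solve 0 (con 1ℤ :* con 1ℤ := con 1ℤ) ≈-refl)
  qbinom⊛poch-≡[<] zero    (suc m) = ≡[<]-trans (≈[0]⇒≡[<] split) (≡[<]-trans
    (≡[<]-⊛ (qbinom⊛poch-≡[<] zero m) (𝟙-y^-≡[<] 1 (suc m) (s≤s z≤n)))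
    (≈[0]⇒≡[<] (solve 0 (con 1ℤ :* con 1ℤ := con 1ℤ) ≈-refl)))
    where
    b₀ b₁ : Series
    b₀ = qbinom (m + 0) m
    b₁ = qbinom (m + 0) (suc m)
    split : (b₀ ⊕ y^ suc m ⊛ b₁) ⊛ (poch m ⊛ 𝟙-y^ suc m) ≈ b₀ ⊛ poch m ⊛ 𝟙-y^ suc m
    split = begin
      (b₀ ⊕ y^ suc m ⊛ b₁) ⊛ (poch m ⊛ 𝟙-y^ suc m)
        ≈⟨ *-congʳ (+-congˡ (*-congˡ (qbinom-> (m + 0) (suc m) (s≤s (ℕ.≤-reflexive (ℕ.+-identityʳ m)))))) ⟩
      (b₀ ⊕ y^ suc m ⊛ 𝟘) ⊛ (poch m ⊛ 𝟙-y^ suc m)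
        ≈⟨ solve 4 (λ b y P o → (b :+ y :* con 0ℤ) :* (P :* o) := b :* P :* o) ≈-refl b₀ (y^ suc m) (poch m) (𝟙-y^ suc m) ⟩
      b₀ ⊛ poch m ⊛ 𝟙-y^ suc m ∎
  qbinom⊛poch-≡[<] (suc a) (suc m) = ≡[<]-trans (≈[0]⇒≡[<] split) (≡[<]-trans
    (≡[<]-⊕ (≡[<]-⊛ (qbinom⊛poch-≡[<] (suc a) m) (λ _ _ → refl))
            (≡[<]-weaken (ℕ.+-monoˡ-≤ (suc a * d) (ℕ.m≤m+n d (m * d))) (q^-⊛-≡[<] (suc m * d) shifted)))
    (≈[0]⇒≡[<] (solve 1 (λ y → con 1ℤ :* (con 1ℤ :+ :- y) :+ y :* con 1ℤ := con 1ℤ) ≈-refl (y^ suc m))))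
    where
    b₀ b₁ : Series
    b₀ = qbinom (m + suc a) m
    b₁ = qbinom (m + suc a) (suc m)
    split : (b₀ ⊕ y^ suc m ⊛ b₁) ⊛ (poch m ⊛ 𝟙-y^ suc m) ≈ b₀ ⊛ poch m ⊛ 𝟙-y^ suc m ⊕ y^ suc m ⊛ (b₁ ⊛ poch (suc m))
    split = solve 5 (λ b₀ y b₁ P o → (b₀ :+ y :* b₁) :* (P :* o) := b₀ :* P :* o :+ y :* (b₁ :* (P :* o)))
                    ≈-refl b₀ (y^ suc m) b₁ (poch m) (𝟙-y^ suc m)
    shifted : b₁ ⊛ poch (suc m) ≡[< suc a * d ] 𝟙
    shifted = ≡[<]-trans (≈[0]⇒≡[<] (*-congʳ (qbinom-cong {k = suc m} (ℕ.+-suc m a) refl))) (qbinom⊛poch-≡[<] a (suc m))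

  triangle-≥ : ∀ j → j ≤ triangle j
  triangle-≥ zero    = z≤n
  triangle-≥ (suc j) = ℕ.m≤n+m (suc j) (triangle j)

  jacobiTerm⊛poch-≡[<] : ∀ n j → j ≤ n → jacobiTerm n j ⊛ poch n ≡[< suc n * d ] y^ triangle j
  jacobiTerm⊛poch-≡[<] n j j≤n = ≡[<]-trans (≈[0]⇒≡[<] reassociate) (≡[<]-trans
    (≡[<]-weaken bound (q^-⊛-≡[<] (triangle j * d) (≡[<]-trans
      (≡[<]-⊛ (λ _ _ → refl) (subst-poch (poch-≡[<] k j)))
      (≡[<]-weaken (ℕ.*-monoˡ-≤ d (s≤s k≤a)) (qbinom⊛poch-≡[<] a k)))))
    (≈[0]⇒≡[<] (solve 1 (λ A → A :* con 1ℤ := A) ≈-refl (y^ triangle j))))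
    where
    k a : ℕ
    k = n ∸ j
    a = suc (n + j)
    j+k≡n : j + k ≡ n
    j+k≡n = ℕ.m+[n∸m]≡n j≤n
    k≤a : k ≤ a
    k≤a = ℕ.≤-trans (ℕ.m∸n≤m n j) (ℕ.≤-trans (ℕ.m≤m+n n j) (ℕ.n≤1+n (n + j)))
    subst-poch : poch (j + k) ≡[< suc k * d ] poch k → poch n ≡[< suc k * d ] poch k
    subst-poch = ≡.subst (λ m → poch m ≡[< suc k * d ] poch k) j+k≡n
    a+k≡N : a + k ≡ suc (n + n)
    a+k≡N = cong suc (≡.trans (ℕ.+-assoc n j k) (cong (n +_) j+k≡n))
    flip : qbinom (suc (n + n)) a ≈ qbinom (k + a) k
    flip = ≈-trans (qbinom-sym _ a k a+k≡N) (qbinom-cong {k = k} (≡.trans (≡.sym a+k≡N) (ℕ.+-comm a k)) refl)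
    reassociate : jacobiTerm n j ⊛ poch n ≈ y^ triangle j ⊛ (qbinom (k + a) k ⊛ poch n)
    reassociate = ≈-trans (*-congʳ (*-congˡ flip))
      (solve 3 (λ A b P → A :* b :* P := A :* (b :* P)) ≈-refl (y^ triangle j) (qbinom (k + a) k) (poch n))
    bound : suc n * d ≤ triangle j * d + suc k * d
    bound = ℕ.≤-trans (ℕ.≤-reflexive (≡.trans (cong (_* d) (≡.sym (≡.trans (ℕ.+-suc j k) (cong suc j+k≡n))))
                                               (ℕ.*-distribʳ-+ d j (suc k))))
                      (ℕ.+-monoˡ-≤ (suc k * d) (ℕ.*-monoˡ-≤ d (triangle-≥ j)))

  jacobi-truncated : ∀ n → poch n ⊛ poch n ⊛ poch n ≡[< suc n * d ] Σ< (suc n) (λ j → weight j ⊛ y^ triangle j)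
  jacobi-truncated n = ≡[<]-trans (≈[0]⇒≡[<] cube≈sum)
    (≡[<]-Σ< (suc n) λ j j<1+n → ≡[<]-⊛ (λ _ _ → refl) (jacobiTerm⊛poch-≡[<] n j (ℕ.≤-pred j<1+n)))
    where
    P : Series
    P = poch n
    cube≈sum : P ⊛ P ⊛ P ≈ Σ< (suc n) (λ j → weight j ⊛ (jacobiTerm n j ⊛ P))
    cube≈sum = begin
      P ⊛ P ⊛ P
        ≈⟨ *-congʳ (jacobiSum≈poch² n) ⟨
      jacobiSum n ⊛ P
        ≈⟨ solve 2 (λ S P → S :* P := P :* S) ≈-refl (jacobiSum n) P ⟩
      P ⊛ jacobiSum n
        ≈⟨ Σ<-⊛ˡ P (λ j → weight j ⊛ jacobiTerm n j) (suc n) ⟨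
      Σ< (suc n) (λ j → P ⊛ (weight j ⊛ jacobiTerm n j))
        ≈⟨ Σ<-cong (suc n) (λ j → solve 3 (λ P w e → P :* (w :* e) := w :* (e :* P)) ≈-refl P (weight j) (jacobiTerm n j)) ⟩
      Σ< (suc n) (λ j → weight j ⊛ (jacobiTerm n j ⊛ P)) ∎

module PartitionSeries where

  open import Defs using (withKinds; partsUpTo; colours; a)
  open import Data.Nat as ℕ using (zero; suc; _+_; _*_; _∸_; _≤_; _<_; z≤n; s≤s; _≤ᵇ_)
  import Data.Nat.Properties as ℕ
  open import Data.Integer as ℤ using (ℤ; 1ℤ)
  import Data.Integer.Properties as ℤ
  open import Data.Bool using (true; false; if_then_else_; T)
  open import Data.List using (applyUpTo)
  open import Data.List.Properties using (map-applyUpTo)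
  open import Data.Nat.ListAction using (sum)
  open import Data.Unit using (tt)
  open import Relation.Nullary using (yes; no; contradiction)
  open import Relation.Binary.PropositionalEquality as ≡ using (_≡_; refl; cong; subst)
  open import Algebra.Bundles using (CommutativeRing)
  open PowerSeries
  open Congruence

  series : (ℕ → ℕ) → Series
  series f n = ℤ.+ f n

  private
    ≤ᵇ-true : ∀ {a b} → a ≤ b → (a ≤ᵇ b) ≡ true
    ≤ᵇ-true {a} {b} a≤b with a ≤ᵇ b | ℕ.≤⇒≤ᵇ a≤b
    ... | true | _ = refl

    ≤ᵇ-false : ∀ {a b} → b < a → (a ≤ᵇ b) ≡ false
    ≤ᵇ-false {a} {b} b<a with a ≤ᵇ b in eq
    ... | false = refl
    ... | true  = contradiction (ℕ.≤ᵇ⇒≤ a b (subst T (≡.sym eq) tt)) (ℕ.<⇒≱ b<a)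

    sum-applyUpTo-zero : ∀ L {f} → (∀ t → f t ≡ 0) → sum (applyUpTo f L) ≡ 0
    sum-applyUpTo-zero zero    z = refl
    sum-applyUpTo-zero (suc L) z = ≡.cong₂ _+_ (z 0) (sum-applyUpTo-zero L (λ t → z (suc t)))

    sum-applyUpTo-cong : ∀ L {f g} → (∀ t → f t ≡ g t) → sum (applyUpTo f L) ≡ sum (applyUpTo g L)
    sum-applyUpTo-cong zero    e = refl
    sum-applyUpTo-cong (suc L) e = ≡.cong₂ _+_ (e 0) (sum-applyUpTo-cong L (λ t → e (suc t)))

    sum-applyUpTo-extend : ∀ L K {f} → (∀ t → L ≤ t → f t ≡ 0) → sum (applyUpTo f (L + K)) ≡ sum (applyUpTo f L)
    sum-applyUpTo-extend zero    K z = sum-applyUpTo-zero K (λ t → z t z≤n)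
    sum-applyUpTo-extend (suc L) K z = cong (_ +_) (sum-applyUpTo-extend L K (λ t L≤t → z (suc t) (s≤s L≤t)))

  module OneMorePartSize (prev : ℕ → ℕ) (M k : ℕ) where

    U V : ℕ → ℕ
    U = withKinds prev (suc M) k
    V = withKinds prev (suc M) (suc k)

    term : ℕ → ℕ → ℕ
    term n t = if t * suc M ≤ᵇ n then U (n ∸ t * suc M) else 0

    V-sum : ∀ n → V n ≡ sum (applyUpTo (term n) (suc n))
    V-sum n = cong sum (map-applyUpTo (λ t → t) (term n) (suc n))

    term-> : ∀ n t → n < t * suc M → term n t ≡ 0
    term-> n t n<tM rewrite ≤ᵇ-false n<tM = refl

    term-shift : ∀ n t → term (suc M + n) (suc t) ≡ term n t
    term-shift n t with t * suc M ℕ.≤? n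
    ... | yes tM≤n rewrite ≤ᵇ-true (ℕ.+-monoʳ-≤ (suc M) tM≤n) | ≤ᵇ-true tM≤n
      = cong U (ℕ.[m+n]∸[m+o]≡n∸o (suc M) n (t * suc M))
    ... | no  tM≰n rewrite ≤ᵇ-false (ℕ.+-monoʳ-< (suc M) (ℕ.≰⇒> tM≰n)) | ≤ᵇ-false (ℕ.≰⇒> tM≰n) = refl

    V-below : ∀ n → n < suc M → V n ≡ U n
    V-below n n<M = ≡.trans (V-sum n) (≡.trans (cong (U n +_) (sum-applyUpTo-zero n λ t →
                      term-> n (suc t) (ℕ.<-≤-trans n<M (ℕ.m≤m+n (suc M) (t * suc M)))))
                    (ℕ.+-identityʳ (U n)))

    V-above : ∀ n → V (suc M + n) ≡ U (suc M + n) + V n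
    V-above n = ≡.trans (V-sum (suc M + n)) (cong (U (suc M + n) +_) (begin
      sum (applyUpTo (λ t → term (suc M + n) (suc t)) (suc M + n))  ≡⟨ sum-applyUpTo-cong (suc M + n) (term-shift n) ⟩
      sum (applyUpTo (term n) (suc M + n))                          ≡⟨ cong (λ L → sum (applyUpTo (term n) L)) (cong suc (ℕ.+-comm M n)) ⟩
      sum (applyUpTo (term n) (suc n + M))                          ≡⟨ sum-applyUpTo-extend (suc n) M (λ t n<t → term-> n t (ℕ.<-≤-trans n<t (ℕ.m≤m*n t (suc M)))) ⟩
      sum (applyUpTo (term n) (suc n))                              ≡⟨ V-sum n ⟨
      V n                                                           ∎))
      where open ≡.≡-Reasoning

  withKinds-below : ∀ prev M k n → n < suc M → withKinds prev (suc M) k n ≡ prev n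
  withKinds-below prev M zero    n n<M = refl
  withKinds-below prev M (suc k) n n<M =
    ≡.trans (OneMorePartSize.V-below prev M k n n<M) (withKinds-below prev M k n n<M)

  partsUpTo-stable : ∀ r s t n → partsUpTo r s (t + n) n ≡ a r s n
  partsUpTo-stable r s zero    n = refl
  partsUpTo-stable r s (suc t) n = ≡.trans
    (withKinds-below (partsUpTo r s (t + n)) (t + n) (colours r s (suc (t + n))) n (s≤s (ℕ.m≤n+m n t)))
    (partsUpTo-stable r s t n)

  module _ (m : ℕ) where

    open Mod m
    open CommutativeRing commutativeRing using (setoid; *-congˡ; *-congʳ)
    open import Relation.Binary.Reasoning.Setoid setoid

    -- The power _^_ is that of the ring modulo m, so the product is formed there.
    colourProduct : ℕ → ℕ → ℕ → Series
    colourProduct r s zero    = 𝟙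
    colourProduct r s (suc L) = colourProduct r s L ⊛ (𝟙-q^ suc L) ^ colours r s (suc L)

    withKinds-step : ∀ prev M k → let open OneMorePartSize prev M k in
      series V ≈ series U ⊕ q^ suc M ⊛ series V
    withKinds-step prev M k = ≗⇒≈ coeff
      where
      open OneMorePartSize prev M k
      coeff : ∀ n → series V n ≡ (series U ⊕ q^ suc M ⊛ series V) n
      coeff n with suc M ℕ.≤? n
      ... | no  M≰n = ≡.sym (≡.trans (⊕-coeff (series U) (q^ suc M ⊛ series V) n)
                          (≡.trans (cong (ℤ._+_ (series U n)) (q^-⊛-coeff-< (suc M) (series V) n (ℕ.≰⇒> M≰n)))
                          (≡.trans (ℤ.+-identityʳ (series U n)) (cong ℤ.+_ (≡.sym (V-below n (ℕ.≰⇒> M≰n)))))))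
      ... | yes M≤n = subst (λ i → series V i ≡ (series U ⊕ q^ suc M ⊛ series V) i) (ℕ.m+[n∸m]≡n M≤n)
                            (≡.sym (≡.trans (⊕-coeff (series U) (q^ suc M ⊛ series V) (suc M + n′))
                            (≡.trans (cong (ℤ._+_ (series U (suc M + n′))) (q^-⊛-coeff-+ (suc M) (series V) n′))
                            (≡.trans (≡.sym (ℤ.pos-+ (U (suc M + n′)) (V n′))) (cong ℤ.+_ (≡.sym (V-above n′)))))))
        where
        n′ : ℕ
        n′ = n ∸ suc M

    withKinds-generating : ∀ prev M k → (𝟙-q^ suc M) ^ k ⊛ series (withKinds prev (suc M) k) ≈ series prev
    withKinds-generating prev M zero    = ≗⇒≈ (⊛-identityˡ (series prev))
    withKinds-generating prev M (suc k) = begin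
      (o ⊛ o ^ k) ⊛ series V
        ≈⟨ solve 3 (λ o p v → (o :* p) :* v := p :* (o :* v)) ≈-refl o (o ^ k) (series V) ⟩
      o ^ k ⊛ (o ⊛ series V)
        ≈⟨ *-congˡ (≈-trans (solve 2 (λ x v → (con 1ℤ :+ :- x) :* v := v :+ :- (x :* v)) ≈-refl (q^ suc M) (series V))
                   (≈-trans (⊕-cong (withKinds-step prev M k) ≈-refl)
                            (solve 2 (λ u w → u :+ w :+ :- w := u) ≈-refl (series U) (q^ suc M ⊛ series V)))) ⟩
      o ^ k ⊛ series U
        ≈⟨ withKinds-generating prev M k ⟩
      series prev ∎
      where
      open OneMorePartSize prev M k
      o : Series
      o = 𝟙-q^ suc M

    partsUpTo-generating : ∀ r s L → colourProduct r s L ⊛ series (partsUpTo r s L) ≈ 𝟙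
    partsUpTo-generating r s zero    = ≗⇒≈ λ n → ≡.trans (⊛-identityˡ _ n) (partsUpTo-0 n)
      where
      partsUpTo-0 : ∀ n → series (partsUpTo r s 0) n ≡ 𝟙 n
      partsUpTo-0 zero    = refl
      partsUpTo-0 (suc n) = refl
    partsUpTo-generating r s (suc L) = begin
      (Q ⊛ o ^ c) ⊛ series (withKinds (partsUpTo r s L) (suc L) c)
        ≈⟨ solve 3 (λ a b x → (a :* b) :* x := a :* (b :* x)) ≈-refl Q (o ^ c) (series (withKinds (partsUpTo r s L) (suc L) c)) ⟩
      Q ⊛ (o ^ c ⊛ series (withKinds (partsUpTo r s L) (suc L) c))
        ≈⟨ *-congˡ (withKinds-generating (partsUpTo r s L) L c) ⟩
      Q ⊛ series (partsUpTo r s L)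
        ≈⟨ partsUpTo-generating r s L ⟩
      𝟙 ∎
      where
      c : ℕ
      c = colours r s (suc L)
      Q o : Series
      Q = colourProduct r s L
      o = 𝟙-q^ suc L

module Frobenius (p : ℕ) (p-prime : Prime p) where

  open import Data.Nat as ℕ using (zero; suc; _+_; _*_; _∸_; _≤_; _<_; s≤s; _!)
  import Data.Nat.Properties as ℕ
  open import Data.Nat.Divisibility as ℕ∣ using (_∣_)
  open import Data.Nat.Combinatorics using (_C_; nCn≡1; k![n∸k]!∣n!)
  open import Data.Nat.Combinatorics.Specification using (nCk≡n!/k![n-k]!)
  open import Data.Nat.DivMod using (m/n*n≡m)
  open import Data.Nat.Primality using (euclidsLemma; prime⇒nonTrivial)
  open import Data.Integer as ℤ using (ℤ; 0ℤ; 1ℤ)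
  import Data.Integer.Properties as ℤ
  import Data.Integer.Divisibility.Signed as ℤ∣
  open import Data.Integer.Tactic.RingSolver using (solve-∀)
  open import Data.Fin as Fin using (Fin; toℕ; fromℕ; inject₁)
  import Data.Fin.Properties as Fin
  open import Data.Sum using (inj₁; inj₂)
  open import Relation.Nullary using (¬_; contradiction)
  open import Relation.Binary.PropositionalEquality as ≡ using (_≡_; cong; subst)
  open import Algebra.Bundles using (CommutativeRing; CommutativeSemiring)
  open PowerSeries
  open Congruence
  open Mod p
  open CommutativeRing commutativeRing using (setoid; commutativeSemiring; +-congˡ; +-congʳ; *-congˡ; *-congʳ)
  open import Relation.Binary.Reasoning.Setoid setoid

  1<p : 1 < p
  1<p = ℕ.nonTrivial⇒n>1 p {{prime⇒nonTrivial p-prime}}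

  prime∤! : ∀ n → n < p → ¬ p ∣ n !
  prime∤! zero    _   p∣1  = ℕ.<⇒≱ 1<p (ℕ∣.∣⇒≤ p∣1)
  prime∤! (suc n) n<p p∣n! with euclidsLemma (suc n) (n !) p-prime p∣n!
  ... | inj₁ p∣1+n = ℕ.<⇒≱ n<p (ℕ∣.∣⇒≤ p∣1+n)
  ... | inj₂ p∣n!  = prime∤! n (ℕ.<-trans (ℕ.n<1+n n) n<p) p∣n!

  prime∣choose : ∀ k → 0 < k → k < p → p ∣ p C k
  prime∣choose k 0<k k<p with euclidsLemma (p C k) (k ! * (p ∸ k) !) p-prime p∣product
    where
    k≤p : k ≤ p
    k≤p = ℕ.<⇒≤ k<p
    product≡p! : (p C k) * (k ! * (p ∸ k) !) ≡ p !
    product≡p! = ≡.trans (cong (_* (k ! * (p ∸ k) !)) (nCk≡n!/k![n-k]! k≤p))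
                         (m/n*n≡m {{ℕ._!*_!≢0 k (p ∸ k)}} (k![n∸k]!∣n! k≤p))
    p∣p! : p ∣ p !
    p∣p! = n∣n! p (ℕ.<-trans ℕ.z<s 1<p)
      where
      n∣n! : ∀ n → 0 < n → n ∣ n !
      n∣n! (suc n) _ = ℕ∣.m∣m*n (n !)
    p∣product : p ∣ (p C k) * (k ! * (p ∸ k) !)
    p∣product = subst (p ∣_) (≡.sym product≡p!) p∣p!
  ... | inj₁ p∣pCk = p∣pCk
  ... | inj₂ p∣k![p-k]! with euclidsLemma (k !) ((p ∸ k) !) p-prime p∣k![p-k]!
  ...   | inj₁ p∣k!   = contradiction p∣k! (prime∤! k k<p)
  ...   | inj₂ p∣[p-k]! = contradiction p∣[p-k]! (prime∤! (p ∸ k) (ℕ.∸-monoʳ-< 0<k (ℕ.<⇒≤ k<p)))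

  open import Algebra.Properties.CommutativeSemiring.Binomial commutativeSemiring using (theorem; binomialTerm)
  open import Algebra.Properties.Semiring.Mult (CommutativeSemiring.semiring commutativeSemiring) using (_×_)
  open import Algebra.Properties.Monoid.Sum (CommutativeSemiring.+-monoid commutativeSemiring)
    using (sum; sum-init-last; sum-cong-≋; sum-replicate-zero)
  open import Data.Vec.Functional using (tail; init; replicate)

  ×-coeff : ∀ c z n → (c × z) n ≡ ℤ.+ c ℤ.* z n
  ×-coeff zero    z n = ≡.trans (𝟘-coeff n) (≡.sym (ℤ.*-zeroˡ (z n)))
  ×-coeff (suc c) z n = ≡.trans (⊕-coeff z (c × z) n)
    (≡.trans (cong (ℤ._+_ (z n)) (×-coeff c z n)) (distrib (z n) (ℤ.+ c)))
    where
    distrib : ∀ x y → x ℤ.+ y ℤ.* x ≡ (1ℤ ℤ.+ y) ℤ.* x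
    distrib = solve-∀

  ×-divisible : ∀ {c} z → p ∣ c → c × z ≈ 𝟘
  ×-divisible {c} z p∣c = mk≈ λ n → subst (ℤ∣._∣_ (ℤ.+ p)) (≡.sym (≡.trans (≡.cong₂ ℤ._-_ (×-coeff c z n) (𝟘-coeff n)) (ℤ.+-identityʳ _)))
    (ℤ∣.∣m⇒∣m*n (z n) (ℤ∣.∣ᵤ⇒∣ {ℤ.+ p} {ℤ.+ c} p∣c))

  freshman-dream : ∀ n → 1 < n → (∀ k → 0 < k → k < n → p ∣ n C k) → ∀ x y → (x ⊕ y) ^ n ≈ x ^ n ⊕ y ^ n
  freshman-dream (suc zero) (s≤s ())
  freshman-dream n@(suc (suc m)) _ p∣nCk x y = begin
    (x ⊕ y) ^ n
      ≈⟨ theorem n x y ⟩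
    t Fin.zero ⊕ sum (tail t)
      ≈⟨ +-congˡ (sum-init-last (tail t)) ⟩
    t Fin.zero ⊕ (sum (init (tail t)) ⊕ t (fromℕ n))
      ≈⟨ +-congˡ (+-congʳ (≈-trans (sum-cong-≋ middle) (sum-replicate-zero (suc m)))) ⟩
    t Fin.zero ⊕ (𝟘 ⊕ t (fromℕ n))
      ≈⟨ ⊕-cong first (+-congˡ last) ⟩
    y ^ n ⊕ (𝟘 ⊕ x ^ n)
      ≈⟨ solve 2 (λ a b → b :+ (con 0ℤ :+ a) := a :+ b) ≈-refl (x ^ n) (y ^ n) ⟩
    x ^ n ⊕ y ^ n ∎
    where
    t : Fin (suc n) → Series
    t = binomialTerm x y n
    first : t Fin.zero ≈ y ^ n
    first = solve 1 (λ z → con 1ℤ :* z :+ con 0ℤ := z) ≈-refl (y ^ n)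
    last : t (fromℕ n) ≈ x ^ n
    last = begin
      t (fromℕ n)                 ≡⟨ cong (λ k → (n C k) × (x ^ k ⊛ y ^ (n ∸ k))) (Fin.toℕ-fromℕ n) ⟩
      (n C n) × (x ^ n ⊛ y ^ (n ∸ n)) ≡⟨ ≡.cong₂ (λ c e → c × (x ^ n ⊛ y ^ e)) (nCn≡1 n) (ℕ.n∸n≡0 n) ⟩
      1 × (x ^ n ⊛ 𝟙)             ≈⟨ solve 1 (λ z → z :* con 1ℤ :+ con 0ℤ := z) ≈-refl (x ^ n) ⟩
      x ^ n                       ∎
    middle : ∀ (i : Fin (suc m)) → init (tail t) i ≈ replicate (suc m) 𝟘 i
    middle i = ×-divisible _ (p∣nCk (suc (toℕ (inject₁ i))) ℕ.z<s
                 (s≤s (ℕ.≤-trans (ℕ.≤-reflexive (cong suc (Fin.toℕ-inject₁ i))) (Fin.toℕ<n i))))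

  frobenius : ∀ x y → (x ⊕ y) ^ p ≈ x ^ p ⊕ y ^ p
  frobenius = freshman-dream p 1<p prime∣choose

  𝟙-^ : ∀ n → 𝟙 ^ n ≈ 𝟙
  𝟙-^ zero    = ≈-refl
  𝟙-^ (suc n) = ≈-trans (*-congˡ (𝟙-^ n)) (≗⇒≈ (⊛-identityˡ 𝟙))

  q^-^ : ∀ i n → (q^ i) ^ n ≈ q^ (n * i)
  q^-^ i zero    = ≈-refl
  q^-^ i (suc n) = ≈-trans (*-congˡ (q^-^ i n)) (≗⇒≈ (q^-+ i (n * i)))

  𝟙-q^-^p : ∀ i → (𝟙-q^ i) ^ p ≈ 𝟙-q^ (p * i)
  𝟙-q^-^p i = begin
    o ^ p
      ≈⟨ solve 2 (λ a b → a := a :+ b :+ :- b) ≈-refl (o ^ p) ((q^ i) ^ p) ⟩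
    o ^ p ⊕ (q^ i) ^ p ⊕ ⊖ ((q^ i) ^ p)
      ≈⟨ ⊕-cong (frobenius o (q^ i)) ≈-refl ⟨
    (o ⊕ q^ i) ^ p ⊕ ⊖ ((q^ i) ^ p)
      ≈⟨ ⊕-cong (≈-trans (^-congˡ p (solve 1 (λ x → con 1ℤ :+ :- x :+ x := con 1ℤ) ≈-refl (q^ i))) (𝟙-^ p))
                (⊖-cong (q^-^ i p)) ⟩
    𝟙-q^ (p * i) ∎
    where
    o : Series
    o = 𝟙-q^ i

module Sparse (p : ℕ) where

  open import Data.Nat as ℕ using (zero; suc; _+_; _*_; _∸_; _≤_; _<_; s≤s)
  import Data.Nat.Properties as ℕ
  open import Data.Nat.Divisibility as ℕ∣ using (_∣_; _∣?_)
  open import Data.Nat.Induction using (<-rec)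
  open import Data.Integer as ℤ using (ℤ; 0ℤ; 1ℤ)
  import Data.Integer.Properties as ℤ
  open import Data.Integer.Divisibility.Signed as ℤ∣ using (divides) renaming (_∣_ to _∣ℤ_)
  open import Data.Integer.Tactic.RingSolver using (solve-∀)
  open import Relation.Nullary using (¬_; yes; no; contradiction)
  open import Relation.Binary.PropositionalEquality as ≡ using (_≡_; _≢_; refl; cong; subst)
  open PowerSeries
  open Congruence

  SupportedOnMultiples : Series → Set
  SupportedOnMultiples f = ∀ n → ¬ p ∣ n → f n ≡ 0ℤ

  𝟙-supported : SupportedOnMultiples 𝟙
  𝟙-supported zero    p∤0 = contradiction (ℕ∣._∣0 p) p∤0
  𝟙-supported (suc n) _   = refl

  𝟙-q^-supported : ∀ i → SupportedOnMultiples (𝟙-q^ (p * i))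
  𝟙-q^-supported i n p∤n = ≡.trans (⊕-coeff 𝟙 (⊖ q^ (p * i)) n)
    (≡.trans (≡.cong₂ ℤ._+_ (𝟙-supported n p∤n) (≡.trans (⊖-coeff (q^ (p * i)) n) (cong ℤ.-_ (q^-coeff-≢ (p * i) n n≢pi))))
             refl)
    where
    n≢pi : n ≢ p * i
    n≢pi n≡pi = p∤n (subst (p ∣_) (≡.sym n≡pi) (ℕ∣.m∣m*n i))

  ⊛-supported : ∀ {f g} → SupportedOnMultiples f → SupportedOnMultiples g → SupportedOnMultiples (f ⊛ g)
  ⊛-supported {f} {g} f-sup g-sup n p∤n =
    ≡.trans (⊛-coeff f g n) (sumBelow-zero (suc n) term-zero)
    where
    term-zero : ∀ a → a < suc n → f a ℤ.* g (n ∸ a) ≡ 0ℤ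
    term-zero a (s≤s a≤n) with p ∣? a
    ... | no  p∤a = ≡.trans (cong (ℤ._* g (n ∸ a)) (f-sup a p∤a)) (ℤ.*-zeroˡ (g (n ∸ a)))
    ... | yes p∣a = ≡.trans (cong (ℤ._*_ (f a)) (g-sup (n ∸ a) p∤n∸a)) (ℤ.*-zeroʳ (f a))
      where
      p∤n∸a : ¬ p ∣ n ∸ a
      p∤n∸a p∣n∸a = p∤n (subst (p ∣_) (ℕ.m+[n∸m]≡n a≤n) (ℕ∣.∣m∣n⇒∣m+n p∣a p∣n∸a))

  module _ (m : ℕ) where
    open Mod m using (_^_)

    ^-supported : ∀ {f} n → SupportedOnMultiples f → SupportedOnMultiples (f ^ n)
    ^-supported zero    _     = 𝟙-supported
    ^-supported (suc n) f-sup = ⊛-supported f-sup (^-supported n f-sup)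

  divisibility-transfer : ∀ {R A E} → R 0 ≡ 1ℤ → SupportedOnMultiples R → R ⊛ A ≈[ p ] E →
    (P : ℕ → Set) → (∀ {u v} → p ∣ u → P (u + v) → P v) →
    ∀ M → (∀ N → N ≤ M → P N → ℤ.+ p ∣ℤ E N) → ∀ N → N ≤ M → P N → ℤ.+ p ∣ℤ A N
  divisibility-transfer {R} {A} {E} R₀≡1 R-sup RA≈E P P-closed M E-div = <-rec Goal step
    where
    Goal : ℕ → Set
    Goal N = N ≤ M → P N → ℤ.+ p ∣ℤ A N
    step : ∀ N → (∀ {N′} → N′ < N → Goal N′) → Goal N
    step N rec N≤M PN = subst (ℤ.+ p ∣ℤ_) convolution-tail≡A (ℤ∣.∣m∣n⇒∣m-n convolution-divisible tail-divisible)
      where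
      tail : ℤ
      tail = sumBelow N (λ a → R (suc a) ℤ.* A (N ∸ suc a))
      convolution-tail≡A : (R ⊛ A) N ℤ.- tail ≡ A N
      convolution-tail≡A = ≡.trans (cong (ℤ._- tail) (⊛-coeff R A N))
        (≡.trans (cong (λ c → c ℤ.* A N ℤ.+ tail ℤ.- tail) R₀≡1) (cancel (A N) tail))
        where
        cancel : ∀ x y → 1ℤ ℤ.* x ℤ.+ y ℤ.- y ≡ x
        cancel = solve-∀
      convolution-divisible : ℤ.+ p ∣ℤ (R ⊛ A) N
      convolution-divisible = subst (ℤ.+ p ∣ℤ_) (sub-add ((R ⊛ A) N) (E N))
        (ℤ∣.∣m∣n⇒∣m+n (coeff≈ RA≈E N) (E-div N N≤M PN))
        where
        sub-add : ∀ x e → x ℤ.- e ℤ.+ e ≡ x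
        sub-add = solve-∀
      term-divisible : ∀ a → a < N → ℤ.+ p ∣ℤ R (suc a) ℤ.* A (N ∸ suc a)
      term-divisible a a<N with p ∣? suc a
      ... | no  p∤a+1 = subst (λ x → ℤ.+ p ∣ℤ x ℤ.* A (N ∸ suc a)) (≡.sym (R-sup (suc a) p∤a+1)) (divides 0ℤ refl)
      ... | yes p∣a+1 = ℤ∣.∣n⇒∣m*n (R (suc a)) (rec (ℕ.∸-monoʳ-< ℕ.z<s a<N)
                          (ℕ.≤-trans (ℕ.m∸n≤m N (suc a)) N≤M)
                          (P-closed p∣a+1 (subst P (≡.sym (ℕ.m+[n∸m]≡n a<N)) PN)))
      tail-divisible : ℤ.+ p ∣ℤ tail
      tail-divisible = sumBelow-divisible N term-divisible

module PartitionCongruence (p : ℕ) (p-prime : Prime p) where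

  open import Defs using (colours; partsUpTo; a)
  open import Data.Nat as ℕ using (zero; suc; _+_; _*_; _≤_; _<_; s≤s; _%_)
  import Data.Nat.Properties as ℕ
  open import Data.Nat.DivMod using ([m+kn]%n≡m%n)
  open import Data.Nat.Divisibility as ℕ∣ using (_∣_)
  open import Data.Nat.Primality using (euclidsLemma)
  open import Data.Nat.Tactic.RingSolver using (solve-∀)
  open import Data.Integer as ℤ using (ℤ; 1ℤ; -1ℤ)
  open import Data.Integer.Divisibility.Signed as ℤ∣ using () renaming (_∣_ to _∣ℤ_)
  open import Data.Sum using ([_,_])
  open import Function using (id)
  open import Relation.Binary.PropositionalEquality as ≡ using (_≡_; refl; cong; subst)
  open import Algebra.Bundles using (CommutativeRing)
  open PowerSeries
  open Congruence
  open Mod p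
  open CommutativeRing commutativeRing using (setoid; *-congˡ; *-congʳ)
  open import Relation.Binary.Reasoning.Setoid setoid
  open PartitionSeries
  open Frobenius p p-prime using (1<p; 𝟙-q^-^p)
  open Sparse p
  module J = TruncatedJacobi 2

  cube : Series → Series
  cube f = f ⊛ f ⊛ f

  triangle-double : ∀ j → J.triangle j * 2 ≡ j * suc j
  triangle-double zero    = refl
  triangle-double (suc j) = ≡.trans (ℕ.*-distribʳ-+ 2 (J.triangle j) (suc j))
    (≡.trans (cong (_+ suc j * 2) (triangle-double j)) (identity j))
    where
    identity : ∀ j → j * suc j + suc j * 2 ≡ suc j * suc (suc j)
    identity = solve-∀

  jacobiCoeff-divisible : ∀ j → p ∣ 4 * (J.triangle j * 2) + 1 → ℤ.+ p ∣ℤ J.jacobiCoeff j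
  jacobiCoeff-divisible j p∣4N+1 =
    ℤ∣.∣n⇒∣m*n (-1ℤ ℤ.^ j) (ℤ∣.∣ᵤ⇒∣ {ℤ.+ p} {ℤ.+ suc (j + j)} ([ id , id ] (euclidsLemma _ _ p-prime p∣square)))
    where
    square : ∀ j → 4 * (j * suc j) + 1 ≡ suc (j + j) * suc (j + j)
    square = solve-∀
    p∣square : p ∣ suc (j + j) * suc (j + j)
    p∣square = subst (p ∣_) (≡.trans (cong (λ t → 4 * t + 1) (triangle-double j)) (square j)) p∣4N+1

  poch³-divisible : ∀ L N → N ≤ L → p ∣ 4 * N + 1 → ℤ.+ p ∣ℤ cube (J.poch L) N
  poch³-divisible L N N≤L p∣4N+1 =
    subst (ℤ.+ p ∣ℤ_) (≡.sym (J.jacobi-truncated L N (s≤s (ℕ.m≤n⇒m≤1+n (ℕ.≤-trans N≤L (ℕ.m≤m*n L 2))))))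
      (Σ<-monomials-divisible p (suc L) J.jacobiCoeff (λ j → J.triangle j * 2) N
        (λ j _ 2Tj≡N → jacobiCoeff-divisible j (subst (λ n → p ∣ 4 * n + 1) (≡.sym 2Tj≡N) p∣4N+1)))

  odd-remainder : ∀ L → suc (L * 2) % 2 ≡ 1
  odd-remainder L = [m+kn]%n≡m%n 1 L 2

  even-remainder : ∀ L → suc (suc (L * 2)) % 2 ≡ 0
  even-remainder L = [m+kn]%n≡m%n 0 (suc L) 2

  module _ (R S u v : ℕ) (R+3≡pu : R + 3 ≡ p * u) (S≡pv : S ≡ p * v) where

    sparseProduct : ℕ → Series
    sparseProduct zero    = 𝟙
    sparseProduct (suc L) = sparseProduct L ⊛ (𝟙-q^ (p * suc (L * 2))) ^ v ⊛ (𝟙-q^ (p * suc (suc (L * 2)))) ^ u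

    colours-odd : ∀ L → colours R S (suc (L * 2)) ≡ S
    colours-odd L rewrite odd-remainder L = refl

    colours-even : ∀ L → colours R S (suc (suc (L * 2))) ≡ R
    colours-even L rewrite even-remainder L = refl

    odd-part-factor : ∀ i → (𝟙-q^ i) ^ S ≈ (𝟙-q^ (p * i)) ^ v
    odd-part-factor i = begin
      (𝟙-q^ i) ^ S         ≡⟨ cong ((𝟙-q^ i) ^_) S≡pv ⟩
      (𝟙-q^ i) ^ (p * v)   ≈⟨ ^-assocʳ (𝟙-q^ i) p v ⟨
      ((𝟙-q^ i) ^ p) ^ v   ≈⟨ ^-congˡ v (𝟙-q^-^p i) ⟩
      (𝟙-q^ (p * i)) ^ v   ∎

    even-part-factor : ∀ i → (𝟙-q^ i) ^ R ⊛ cube (𝟙-q^ i) ≈ (𝟙-q^ (p * i)) ^ u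
    even-part-factor i = begin
      o ^ R ⊛ cube o       ≈⟨ *-congˡ (solve 1 (λ o → o :* o :* o := o :* (o :* (o :* con 1ℤ))) ≈-refl o) ⟩
      o ^ R ⊛ o ^ 3        ≈⟨ ^-homo-* o R 3 ⟨
      o ^ (R + 3)          ≡⟨ cong (o ^_) R+3≡pu ⟩
      o ^ (p * u)          ≈⟨ ^-assocʳ o p u ⟨
      (o ^ p) ^ u          ≈⟨ ^-congˡ u (𝟙-q^-^p i) ⟩
      (𝟙-q^ (p * i)) ^ u   ∎
      where
      o : Series
      o = 𝟙-q^ i

    colourProduct⊛poch³ : ∀ L → colourProduct p R S (L * 2) ⊛ cube (J.poch L) ≈ sparseProduct L
    colourProduct⊛poch³ zero    = solve 0 (con 1ℤ :* (con 1ℤ :* con 1ℤ :* con 1ℤ) := con 1ℤ) ≈-refl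
    colourProduct⊛poch³ (suc L) = begin
      C ⊛ o₁ ^ c₁ ⊛ o₂ ^ c₂ ⊛ cube (P ⊛ o₂)
        ≡⟨ ≡.cong₂ (λ c₁ c₂ → C ⊛ o₁ ^ c₁ ⊛ o₂ ^ c₂ ⊛ cube (P ⊛ o₂)) (colours-odd L) (colours-even L) ⟩
      C ⊛ o₁ ^ S ⊛ o₂ ^ R ⊛ cube (P ⊛ o₂)
        ≈⟨ solve 5 (λ C x y P o → C :* x :* y :* ((P :* o) :* (P :* o) :* (P :* o)) := C :* (P :* P :* P) :* x :* (y :* (o :* o :* o)))
                 ≈-refl C (o₁ ^ S) (o₂ ^ R) P o₂ ⟩
      C ⊛ cube P ⊛ o₁ ^ S ⊛ (o₂ ^ R ⊛ cube o₂)
        ≈⟨ ⊛-cong (⊛-cong (colourProduct⊛poch³ L) (odd-part-factor (suc (L * 2)))) (even-part-factor (suc (suc (L * 2)))) ⟩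
      sparseProduct (suc L) ∎
      where
      C P o₁ o₂ : Series
      C  = colourProduct p R S (L * 2)
      P  = J.poch L
      o₁ = 𝟙-q^ suc (L * 2)
      o₂ = 𝟙-q^ suc (suc (L * 2))
      c₁ c₂ : ℕ
      c₁ = colours R S (suc (L * 2))
      c₂ = colours R S (suc (suc (L * 2)))

    sparseProduct⊛partitions : ∀ L → sparseProduct L ⊛ series (partsUpTo R S (L * 2)) ≈ cube (J.poch L)
    sparseProduct⊛partitions L = begin
      sparseProduct L ⊛ A           ≈⟨ *-congʳ (colourProduct⊛poch³ L) ⟨
      C ⊛ cube P ⊛ A                ≈⟨ solve 3 (λ C P A → C :* (P :* P :* P) :* A := C :* A :* (P :* P :* P)) ≈-refl C P A ⟩
      C ⊛ A ⊛ cube P                ≈⟨ *-congʳ (partsUpTo-generating p R S (L * 2)) ⟩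
      𝟙 ⊛ cube P                    ≈⟨ ≗⇒≈ (⊛-identityˡ (cube P)) ⟩
      cube P                        ∎
      where
      A C P : Series
      A = series (partsUpTo R S (L * 2))
      C = colourProduct p R S (L * 2)
      P = J.poch L

    sparseProduct-supported : ∀ L → SupportedOnMultiples (sparseProduct L)
    sparseProduct-supported zero    = 𝟙-supported
    sparseProduct-supported (suc L) = ⊛-supported (⊛-supported (sparseProduct-supported L)
      (^-supported p v (𝟙-q^-supported (suc (L * 2))))) (^-supported p u (𝟙-q^-supported (suc (suc (L * 2)))))

    sparseProduct-constant : ∀ L → sparseProduct L 0 ≡ 1ℤ
    sparseProduct-constant zero    = refl
    sparseProduct-constant (suc L) = ≡.trans (⊛-coeff-0 _ _) (≡.cong₂ ℤ._*_
      (≡.trans (⊛-coeff-0 _ _) (≡.cong₂ ℤ._*_ (sparseProduct-constant L) (^-constant v (L * 2))))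
      (^-constant u (suc (L * 2))))
      where
      ^-constant : ∀ e k → ((𝟙-q^ (p * suc k)) ^ e) 0 ≡ 1ℤ
      ^-constant zero    k = refl
      ^-constant (suc e) k = ≡.trans (⊛-coeff-0 _ _) (≡.cong₂ ℤ._*_ factor-constant (^-constant e k))
        where
        0<p[k+1] : 0 < p * suc k
        0<p[k+1] = ℕ.<-≤-trans (ℕ.<-trans ℕ.z<s 1<p) (ℕ.m≤m*n p (suc k))
        factor-constant : (𝟙-q^ (p * suc k)) 0 ≡ 1ℤ
        factor-constant = ≡.trans (⊕-coeff 𝟙 (⊖ q^ (p * suc k)) 0)
          (cong (ℤ._+_ 1ℤ) (≡.trans (⊖-coeff (q^ (p * suc k)) 0) (cong ℤ.-_ (q^-coeff-< (p * suc k) 0 0<p[k+1]))))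

    partitions-divisible : ∀ N → p ∣ 4 * N + 1 → p ∣ a R S N
    partitions-divisible N p∣4N+1 = subst (p ∣_) A≡a
      (ℤ∣.∣⇒∣ᵤ (divisibility-transfer (sparseProduct-constant N) (sparseProduct-supported N) (sparseProduct⊛partitions N)
        (λ n → p ∣ 4 * n + 1) closed N (λ n n≤N → poch³-divisible N n n≤N) N ℕ.≤-refl p∣4N+1))
      where
      A≡a : partsUpTo R S (N * 2) N ≡ a R S N
      A≡a = ≡.trans (cong (λ L → partsUpTo R S L N) (≡.trans (ℕ.*-comm N 2) (cong (N +_) (ℕ.+-identityʳ N))))
                    (partsUpTo-stable R S N N)
      closed : ∀ {m n} → p ∣ m → p ∣ 4 * (m + n) + 1 → p ∣ 4 * n + 1
      closed {m} {n} p∣m p∣4[m+n]+1 = ℕ∣.∣m+n∣m⇒∣n (subst (p ∣_) (regroup m n) p∣4[m+n]+1) (ℕ∣.∣n⇒∣m*n 4 p∣m)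
        where
        regroup : ∀ m n → 4 * (m + n) + 1 ≡ 4 * m + (4 * n + 1)
        regroup = solve-∀

open import Defs using (a)
open import Data.Nat using (suc; _+_; _*_; _∸_; _≤_)
import Data.Nat.Properties as ℕ
open import Data.Nat.Divisibility using (_∣_; ∣-refl; ∣m∣n⇒∣m+n; ∣n⇒∣m*n)
open import Data.Nat.Tactic.RingSolver using (solve-∀)
open import Relation.Binary.PropositionalEquality using (_≡_; sym; trans; cong; subst)

theorem1p14 : (p r : ℕ) → Prime p → 5 ≤ p → 1 ≤ r → r ≤ p ∸ 1 → p ∣ (4 * r + 1) →
    (n k j : ℕ) → j ≤ k →
    p ∣ a (p * (k ∸ j) + (p ∸ 3)) (p * k + p) (p * n + r)
theorem1p14 p r p-prime 5≤p _ _ p∣4r+1 n k j _ =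
  PartitionCongruence.partitions-divisible p p-prime _ _ (suc (k ∸ j)) (suc k) R+3≡pu S≡pv (p * n + r) p∣4N+1
  where
  R+3≡pu : p * (k ∸ j) + (p ∸ 3) + 3 ≡ p * suc (k ∸ j)
  R+3≡pu = trans (ℕ.+-assoc (p * (k ∸ j)) (p ∸ 3) 3)
    (trans (cong (p * (k ∸ j) +_) (ℕ.m∸n+n≡m (ℕ.≤-trans (ℕ.m≤n+m 3 2) 5≤p)))
           (trans (ℕ.+-comm (p * (k ∸ j)) p) (sym (ℕ.*-suc p (k ∸ j)))))
  S≡pv : p * k + p ≡ p * suc k
  S≡pv = trans (ℕ.+-comm (p * k) p) (sym (ℕ.*-suc p k))
  p∣4N+1 : p ∣ 4 * (p * n + r) + 1
  p∣4N+1 = subst (p ∣_) (regroup p n r) (∣m∣n⇒∣m+n (∣n⇒∣m*n (4 * n) ∣-refl) p∣4r+1)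
    where
    regroup : ∀ p n r → 4 * n * p + (4 * r + 1) ≡ 4 * (p * n + r) + 1
    regroup = solve-∀
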